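{- Let $u$ be a nonzero integer square such that $p=4u^{2}+12u+1$ is a prime. Let $\alpha$ be a primitive element of $\mathbb{F}_p$ and for $0\le i\le 3$ let $C_i^4=\alpha^i\langle\alpha^4\rangle$. (1) Suppose $u$ is even. Then $2 \in C_{0}^{4}$. Moreover, (1a) up to the sign of $y$, $(x,y)=(-2u+1, \pm 2u^{1/2})$ is the unique pair of integers with $p=x^{2}+4y^{2}$ and $x\equiv 1\pmod 4$; (1b) up to the sign of $b$, $(a,b)=(2u+1, \pm 2u^{1/2})$ is the unique pair of integers with $p=a^{2}+2b^{2}$ and $a\equiv 1\pmod 4$. (2) Suppose $u$ is odd. Then $2 \in C_{2}^{4}$. Moreover, (2a) up to the sign of $y$, $(x,y)=(2u-1, \pm 2u^{1/2})$ is the unique pair of integers with $p=x^{2}+4y^{2}$ and $x\equiv 1\pmod 4$; (2b) up to the sign of $b$, $(a,b)=(-2u-1, \pm 2u^{1/2})$ is the unique pair of integers with $p=a^{2}+2b^{2}$ and $a\equiv 1\pmod 4$.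
   Context: $C_i^4=\alpha^i\langle\alpha^4\rangle$ are the cyclotomic cosets of order $4$ in $\mathbb{F}_p^*$ with respect to the primitive element $\alpha$; in particular $C_0^4$ is the subgroup of fourth powers. -}

module Defs where

open import Data.Nat using (ℕ; _+_; _*_; _^_; _%_; _≤_; _<_)
open import Data.Integer as ℤ using (ℤ; +_)
open import Data.Integer.Divisibility as ℤd using ()
open import Data.Product using (∃; _×_)
open import Data.Sum using (_⊎_)
open import Relation.Binary.PropositionalEquality using (_≡_)
open import Relation.Nullary using (¬_)

ModEq : ℕ → ℕ → ℕ → Set
ModEq p a b = (+ p) ℤd.∣ ((+ a) ℤ.- (+ b))

Primitive : ℕ → ℕ → Set
Primitive p α = ¬ (ModEq p α 0) × (∀ x → 1 ≤ x → x < p → ∃ λ k → ModEq p (α ^ k) x)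

InCoset4 : ℕ → ℕ → ℕ → ℕ → Set
InCoset4 p α i x = ∃ λ k → ModEq p (α ^ (4 * k + i)) x

OneMod4 : ℤ → Set
OneMod4 x = (+ 4) ℤd.∣ (x ℤ.- + 1)

pOf : ℕ → ℕ
pOf u = 4 * (u * u) + 12 * u + 1

{-# OPTIONS --safe #-}
module Submission where

-- Write u = s², q = 2u + 3 and Q = (p − 1)/4.  Since q² = p + 8, the class of 8 is a square,
-- so 2^{3Q} ≡ q^{2Q}, which Gauss's lemma evaluates as (−1)^μ, μ being the number of
-- k ≤ 2Q whose multiple k q has residue above 2Q.  As 2^{4Q} ≡ 1 this gives 2^Q ≡ (−1)^μ,
-- and against a primitive root α this places 2 in C₀ or C₂.  Splitting k = m q + r gives
-- k q ≡ r q + 8 m, so μ becomes an explicit lattice-point count whose parity depends only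
-- on u mod 8: μ is even for u ≡ 0, 4 and odd for u ≡ 1 (mod 8); u = 1, where p = 17, is
-- checked by hand.
--
-- The identities p = (2u − 1)² + 4 (2s)² = (2u + 1)² + 2 (2s)² give the representations.
-- They are unique up to signs: if p = a² + n b² = c² + n d² with n ≥ 2, then p divides
-- (ad − bc)(ad + bc) = p (d² − b²), and by the Brahmagupta identities a multiple of p
-- among ad ∓ bc is too small to be nonzero, so b² = d²; the condition x ≡ 1 (mod 4)
-- then fixes the sign of x.

open import Algebra.Bundles using (CommutativeMonoid)
open import Data.Bool.Base using (if_then_else_)
open import Data.Empty using (⊥-elim)
open import Data.Fin.Base using (Fin; toℕ; fromℕ<; punchOut)
open import Data.Fin.Permutation using (Permutation′; permutation)
open import Data.Fin.Properties
  using (any?; injective⇒≤; punchOut-injective; toℕ<n; toℕ-fromℕ<; toℕ-injective) renaming (_≟_ to _≟ᶠ_)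
open import Data.Integer as ℤ using (ℤ; +_; 0ℤ; 1ℤ; -1ℤ)
import Data.Integer.Properties as ℤP
open import Data.Integer.Divisibility.Signed
  using (_∣_; divides; ∣ᵤ⇒∣; ∣⇒∣ᵤ; ∣-refl; ∣m∣n⇒∣m+n; ∣m⇒∣-m; ∣m⇒∣m*n; ∣n⇒∣m*n)
import Data.Integer.Tactic.RingSolver as ℤ-Solver
open import Data.List.Base using (_∷_; [])
open import Data.Nat.Base as ℕ using (ℕ; zero; suc; NonZero; _%_; _/_; z≤n; s≤s; s≤s⁻¹)
import Data.Nat.Divisibility as ℕ∣
open import Data.Nat.DivMod using (m≡m%n+[m/n]*n; m%n<n; m%n*o≡m*o%[n*o]; m<n⇒m%n≡m; [m+kn]%n≡m%n)
open import Data.Nat.Primality using (Prime; euclidsLemma; prime⇒nonZero; prime⇒nonTrivial)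
import Data.Nat.Properties as ℕP
import Data.Nat.Tactic.RingSolver as ℕ-Solver
open import Data.Product using (∃; ∃-syntax; _×_; _,_; proj₁; proj₂)
open import Data.Sum using (_⊎_; inj₁; inj₂; [_,_]′)
open import Defs
open import Function.Base using (_∘_)
open import Function.Bundles using (_⇔_; mk⇔)
open import Function.Definitions using (Injective)
open import Level using (0ℓ)
open import Relation.Binary.Bundles using (Setoid)
open import Relation.Binary.Definitions using (tri<; tri≈; tri>)
open import Relation.Binary.PropositionalEquality
  using (_≡_; _≢_; refl; sym; trans; cong; cong₂; subst; subst₂; module ≡-Reasoning)
open import Relation.Binary.Structures using (IsEquivalence)
open import Relation.Nullary.Decidable using (Dec; yes; no; does; ¬?; dec-true; dec-false; does-⇔)
open import Relation.Nullary.Negation using (¬_; contradiction)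
open import Relation.Unary using (Decidable)

pos-^ : ∀ a k → + (a ℕ.^ k) ≡ (+ a) ℤ.^ k
pos-^ a zero    = refl
pos-^ a (suc k) = trans (ℤP.pos-* a (a ℕ.^ k)) (cong (+ a ℤ.*_) (pos-^ a k))

-1^[2*m]≡1 : ∀ m → -1ℤ ℤ.^ (2 ℕ.* m) ≡ 1ℤ
-1^[2*m]≡1 m = trans (sym (ℤP.^-*-assoc -1ℤ 2 m)) (ℤP.^-zeroˡ m)

module Congruence (n : ℕ) where

  open import Data.Integer using (_+_; _-_; _*_; -_; _^_)

  infix 4 _≈_
  record _≈_ (x y : ℤ) : Set where
    constructor mk≈
    field ∣-difference : + n ∣ x - y
  open _≈_ public

  private
    via : ∀ {d e} → d ≡ e → + n ∣ d → + n ∣ e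
    via eq = subst (+ n ∣_) eq

  ≈-reflexive : ∀ {x y} → x ≡ y → x ≈ y
  ≈-reflexive {x} refl = mk≈ (via (sym (ℤP.+-inverseʳ x)) (∣n⇒∣m*n 0ℤ ∣-refl))

  ≈-refl : ∀ {x} → x ≈ x
  ≈-refl = ≈-reflexive refl

  ≈-sym : ∀ {x y} → x ≈ y → y ≈ x
  ≈-sym {x} {y} (mk≈ d) = mk≈ (via (flip x y) (∣m⇒∣-m d))
    where
    flip : ∀ x y → - (x - y) ≡ y - x
    flip = ℤ-Solver.solve-∀

  ≈-trans : ∀ {x y z} → x ≈ y → y ≈ z → x ≈ z
  ≈-trans {x} {y} {z} (mk≈ d) (mk≈ e) = mk≈ (via (telescope x y z) (∣m∣n⇒∣m+n d e))
    where
    telescope : ∀ x y z → (x - y) + (y - z) ≡ x - z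
    telescope = ℤ-Solver.solve-∀

  ≈-isEquivalence : IsEquivalence _≈_
  ≈-isEquivalence = record { refl = ≈-refl ; sym = ≈-sym ; trans = ≈-trans }

  setoid : Setoid 0ℓ 0ℓ
  setoid = record { isEquivalence = ≈-isEquivalence }

  module ≈-Reasoning where
    open import Relation.Binary.Reasoning.Setoid setoid public

  +-cong : ∀ {x y z w} → x ≈ y → z ≈ w → x + z ≈ y + w
  +-cong {x} {y} {z} {w} (mk≈ d) (mk≈ e) = mk≈ (via (regroup x y z w) (∣m∣n⇒∣m+n d e))
    where
    regroup : ∀ x y z w → (x - y) + (z - w) ≡ (x + z) - (y + w)
    regroup = ℤ-Solver.solve-∀

  *-cong : ∀ {x y z w} → x ≈ y → z ≈ w → x * z ≈ y * w
  *-cong {x} {y} {z} {w} (mk≈ d) (mk≈ e) =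
    mk≈ (via (regroup x y z w) (∣m∣n⇒∣m+n (∣m⇒∣m*n z d) (∣n⇒∣m*n y e)))
    where
    regroup : ∀ x y z w → (x - y) * z + y * (z - w) ≡ x * z - y * w
    regroup = ℤ-Solver.solve-∀

  ^-cong : ∀ {x y} k → x ≈ y → x ^ k ≈ y ^ k
  ^-cong ℕ.zero    _   = ≈-refl
  ^-cong (suc k) x≈y = *-cong x≈y (^-cong k x≈y)

  *-1-commutativeMonoid : CommutativeMonoid 0ℓ 0ℓ
  *-1-commutativeMonoid = record
    { Carrier = ℤ
    ; _≈_ = _≈_
    ; _∙_ = ℤ._*_
    ; ε = 1ℤ
    ; isCommutativeMonoid = record
      { isMonoid = record
        { isSemigroup = record
          { isMagma = record { isEquivalence = ≈-isEquivalence ; ∙-cong = *-cong }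
          ; assoc = λ x y z → ≈-reflexive (ℤP.*-assoc x y z) }
        ; identity = (λ x → ≈-reflexive (ℤP.*-identityˡ x)) , (λ x → ≈-reflexive (ℤP.*-identityʳ x)) }
      ; comm = λ x y → ≈-reflexive (ℤP.*-comm x y) } }

  +-multiple : ∀ x k → x + k * + n ≈ x
  +-multiple x k = mk≈ (via (cancel x k (+ n)) (∣n⇒∣m*n k ∣-refl))
    where
    cancel : ∀ x k N → k * N ≡ x + k * N - x
    cancel = ℤ-Solver.solve-∀

  ModEq⇒≈ : ∀ {a b} → ModEq n a b → + a ≈ + b
  ModEq⇒≈ = mk≈ ∘ ∣ᵤ⇒∣

  ≈⇒ModEq : ∀ {a b} → + a ≈ + b → ModEq n a b
  ≈⇒ModEq = ∣⇒∣ᵤ ∘ ∣-difference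

  ^-%-≈ : ∀ {x} d .{{_ : NonZero d}} → x ^ d ≈ 1ℤ → ∀ k → x ^ k ≈ x ^ (k ℕ.% d)
  ^-%-≈ {x} d xᵈ≈1 k = begin
    x ^ k                        ≡⟨ cong (x ^_) k≡ ⟩
    x ^ (r ℕ.+ d ℕ.* m)          ≡⟨ ℤP.^-distribˡ-+-* x r (d ℕ.* m) ⟩
    x ^ r * x ^ (d ℕ.* m)        ≡⟨ cong (x ^ r *_) (ℤP.^-*-assoc x d m) ⟨
    x ^ r * (x ^ d) ^ m          ≈⟨ *-cong (≈-refl {x ^ r}) (^-cong m xᵈ≈1) ⟩
    x ^ r * 1ℤ ^ m               ≡⟨ cong (x ^ r *_) (ℤP.^-zeroˡ m) ⟩
    x ^ r * 1ℤ                   ≡⟨ ℤP.*-identityʳ (x ^ r) ⟩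
    x ^ r                        ∎
    where
    open ≈-Reasoning
    r = k ℕ.% d
    m = k ℕ./ d
    k≡ : k ≡ r ℕ.+ d ℕ.* m
    k≡ = trans (m≡m%n+[m/n]*n k d) (cong (r ℕ.+_) (ℕP.*-comm m d))

  ≈0⇒∣ : ∀ {x} → x ≈ 0ℤ → + n ∣ x
  ≈0⇒∣ {x} (mk≈ d) = via (ℤP.+-identityʳ x) d

  ∣⇒≈0 : ∀ {x} → + n ∣ x → x ≈ 0ℤ
  ∣⇒≈0 {x} d = mk≈ (via (sym (ℤP.+-identityʳ x)) d)

  n≈0 : + n ≈ 0ℤ
  n≈0 = ∣⇒≈0 ∣-refl

  ≈-% : ∀ m .{{_ : NonZero n}} → + m ≈ + (m ℕ.% n)
  ≈-% m = subst (_≈ + (m ℕ.% n)) (sym +m≡) (+-multiple (+ (m ℕ.% n)) (+ (m ℕ./ n)))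
    where
    +m≡ : + m ≡ + (m ℕ.% n) + + (m ℕ./ n) * + n
    +m≡ = trans (cong +_ (m≡m%n+[m/n]*n m n))
                (trans (ℤP.pos-+ (m ℕ.% n) (m ℕ./ n ℕ.* n))
                       (cong (λ z → + (m ℕ.% n) + z) (ℤP.pos-* (m ℕ./ n) n)))

  ∤-small : ∀ {k} → 0 ℕ.< k → k ℕ.< n → ¬ (+ n ∣ + k)
  ∤-small {suc k} _ k<n d = ℕP.<⇒≱ k<n (ℕ∣.∣⇒≤ (∣⇒∣ᵤ d))

  ∣-difference⇒≡ : ∀ {j k} → k ℕ.≤ j → j ℕ.< n → + n ∣ + j - + k → j ≡ k
  ∣-difference⇒≡ {j} {k} k≤j j<n d with j ℕ.∸ k in eq
  ... | ℕ.zero = ℕP.≤-antisym (ℕP.m∸n≡0⇒m≤n eq) k≤j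
  ... | suc t  = ⊥-elim (∤-small (ℕ.s≤s ℕ.z≤n) t<n (via difference d))
    where
    t<n : suc t ℕ.< n
    t<n = ℕP.≤-<-trans (subst (ℕ._≤ j) eq (ℕP.m∸n≤m j k)) j<n
    difference : + j - + k ≡ + suc t
    difference = trans (ℤP.m-n≡m⊖n j k) (trans (ℤP.⊖-≥ k≤j) (cong +_ eq))

  ≈⇒≡ : ∀ {j k} → j ℕ.< n → k ℕ.< n → + j ≈ + k → j ≡ k
  ≈⇒≡ {j} {k} j<n k<n j≈k with ℕP.≤-total k j
  ... | inj₁ k≤j = ∣-difference⇒≡ k≤j j<n (∣-difference j≈k)
  ... | inj₂ j≤k = sym (∣-difference⇒≡ j≤k k<n (∣-difference (≈-sym j≈k)))

  module _ (n-prime : Prime n) where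

    euclid : ∀ x y → + n ∣ x * y → + n ∣ x ⊎ + n ∣ y
    euclid x y n∣xy with euclidsLemma ℤ.∣ x ∣ ℤ.∣ y ∣ n-prime
                           (subst (n ℕ∣.∣_) (ℤP.abs-* x y) (∣⇒∣ᵤ n∣xy))
    ... | inj₁ n∣x = inj₁ (∣ᵤ⇒∣ n∣x)
    ... | inj₂ n∣y = inj₂ (∣ᵤ⇒∣ n∣y)

    ∤-* : ∀ {x y} → ¬ (+ n ∣ x) → ¬ (+ n ∣ y) → ¬ (+ n ∣ x * y)
    ∤-* {x} {y} n∤x n∤y d with euclid x y d
    ... | inj₁ n∣x = n∤x n∣x
    ... | inj₂ n∣y = n∤y n∣y

    ∤-^ : ∀ {x} → ¬ (+ n ∣ x) → ∀ k → ¬ (+ n ∣ x ^ k)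
    ∤-^ n∤x ℕ.zero  = ∤-small (ℕ.s≤s ℕ.z≤n) (ℕ.nonTrivial⇒n>1 n {{prime⇒nonTrivial n-prime}})
    ∤-^ n∤x (suc k) = ∤-* n∤x (∤-^ n∤x k)

    *-cancelʳ-≈ : ∀ {x y} c → ¬ (+ n ∣ c) → x * c ≈ y * c → x ≈ y
    *-cancelʳ-≈ {x} {y} c n∤c (mk≈ d) with euclid (x - y) c (via (factor x y c) d)
      where
      factor : ∀ x y c → x * c - y * c ≡ (x - y) * c
      factor = ℤ-Solver.solve-∀
    ... | inj₁ n∣x-y = mk≈ n∣x-y
    ... | inj₂ n∣c   = ⊥-elim (n∤c n∣c)

    square-root-of-1 : ∀ {x} → x * x ≈ 1ℤ → x ≈ 1ℤ ⊎ x ≈ -1ℤ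
    square-root-of-1 {x} (mk≈ d) with euclid (x - 1ℤ) (x + 1ℤ) (via (factor x) d)
      where
      factor : ∀ x → x * x - 1ℤ ≡ (x - 1ℤ) * (x + 1ℤ)
      factor = ℤ-Solver.solve-∀
    ... | inj₁ n∣x-1 = inj₁ (mk≈ n∣x-1)
    ... | inj₂ n∣x+1 = inj₂ (mk≈ n∣x+1)

module Sums where

  open import Data.Nat.Base using (_+_; _*_; _≤_; _<_)
  open import Data.Nat.DivMod using (m*n/n≡m; m/n*n≤m; /-monoˡ-≤; +-distrib-/-∣ʳ)
  open import Data.Nat.Divisibility using (n∣m*n)
  open import Data.Nat.Tactic.RingSolver using (solve-∀)

  sumTo : ℕ → (ℕ → ℕ) → ℕ
  sumTo zero    f = 0
  sumTo (suc n) f = f 0 + sumTo n (f ∘ suc)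

  syntax sumTo n (λ i → x) = ∑[ i < n ] x

  sum-cong : ∀ n {f g : ℕ → ℕ} → (∀ i → i < n → f i ≡ g i) → sumTo n f ≡ sumTo n g
  sum-cong zero    f≗g = refl
  sum-cong (suc n) f≗g = cong₂ _+_ (f≗g 0 (s≤s z≤n)) (sum-cong n (λ i i<n → f≗g (suc i) (s≤s i<n)))

  sum-distrib-+ : ∀ n (f g : ℕ → ℕ) → ∑[ i < n ] (f i + g i) ≡ sumTo n f + sumTo n g
  sum-distrib-+ zero    f g = refl
  sum-distrib-+ (suc n) f g =
    trans (cong (λ z → f 0 + g 0 + z) (sum-distrib-+ n (f ∘ suc) (g ∘ suc)))
          (interchange (f 0) (g 0) (sumTo n (f ∘ suc)) (sumTo n (g ∘ suc)))
    where
    interchange : ∀ a b c d → a + b + (c + d) ≡ a + c + (b + d)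
    interchange = solve-∀

  sum-const : ∀ n c → ∑[ i < n ] c ≡ n * c
  sum-const zero    c = refl
  sum-const (suc n) c = cong (λ z → c + z) (sum-const n c)

  sum-++ : ∀ m n (f : ℕ → ℕ) → sumTo (m + n) f ≡ sumTo m f + ∑[ i < n ] f (m + i)
  sum-++ zero    n f = refl
  sum-++ (suc m) n f = trans (cong (λ z → f 0 + z) (sum-++ m n (f ∘ suc))) (sym (ℕP.+-assoc (f 0) _ _))

  sum-blocks : ∀ m q (f : ℕ → ℕ) → sumTo (m * q) f ≡ ∑[ i < m ] ∑[ r < q ] f (i * q + r)
  sum-blocks zero    q f = refl
  sum-blocks (suc m) q f = begin
    sumTo (q + m * q) f                                     ≡⟨ sum-++ q (m * q) f ⟩
    sumTo q f + sumTo (m * q) (λ k → f (q + k))             ≡⟨ cong (sumTo q f ℕ.+_) (sum-blocks m q _) ⟩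
    sumTo q f + ∑[ i < m ] ∑[ r < q ] f (q + (i * q + r))   ≡⟨ cong (sumTo q f ℕ.+_) (sum-cong m regroup) ⟩
    sumTo q f + ∑[ i < m ] ∑[ r < q ] f (suc i * q + r)     ∎
    where
    open ≡-Reasoning
    regroup : ∀ i → i < m → ∑[ r < q ] f (q + (i * q + r)) ≡ ∑[ r < q ] f (suc i * q + r)
    regroup i _ = sum-cong q (λ r _ → cong f (sym (ℕP.+-assoc q (i * q) r)))

  sum-comm : ∀ m n (f : ℕ → ℕ → ℕ) → ∑[ i < m ] ∑[ j < n ] f i j ≡ ∑[ j < n ] ∑[ i < m ] f i j
  sum-comm zero    n f = sym (trans (sum-const n 0) (ℕP.*-zeroʳ n))
  sum-comm (suc m) n f = trans (cong (sumTo n (f 0) ℕ.+_) (sum-comm m n (f ∘ suc)))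
                               (sym (sum-distrib-+ n (f 0) (λ j → ∑[ i < m ] f (suc i) j)))

  ⟦_⟧ : {P : Set} → Dec P → ℕ
  ⟦ P? ⟧ = if does P? then 1 else 0

  ⟦⟧-cong : {P Q : Set} → P ⇔ Q → (P? : Dec P) (Q? : Dec Q) → ⟦ P? ⟧ ≡ ⟦ Q? ⟧
  ⟦⟧-cong P⇔Q P? Q? = cong (if_then 1 else 0) (does-⇔ P⇔Q P? Q?)

  ⟦⟧-yes : {P : Set} (P? : Dec P) → P → ⟦ P? ⟧ ≡ 1
  ⟦⟧-yes P? p = cong (if_then 1 else 0) (dec-true P? p)

  ⟦⟧-no : {P : Set} (P? : Dec P) → ¬ P → ⟦ P? ⟧ ≡ 0
  ⟦⟧-no P? ¬p = cong (if_then 1 else 0) (dec-false P? ¬p)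

  ⟦¬⟧+⟦⟧ : {P : Set} (P? : Dec P) → ⟦ ¬? P? ⟧ + ⟦ P? ⟧ ≡ 1
  ⟦¬⟧+⟦⟧ (yes _) = refl
  ⟦¬⟧+⟦⟧ (no _)  = refl

  count : {P : ℕ → Set} → ℕ → Decidable P → ℕ
  count n P? = ∑[ i < n ] ⟦ P? i ⟧

  count-cong : {P Q : ℕ → Set} → ∀ n (P? : Decidable P) (Q? : Decidable Q) → (∀ i → i < n → P i ⇔ Q i) →
               count n P? ≡ count n Q?
  count-cong n P? Q? P⇔Q = sum-cong n (λ i i<n → ⟦⟧-cong (P⇔Q i i<n) (P? i) (Q? i))

  count-all : {P : ℕ → Set} → ∀ n (P? : Decidable P) → (∀ i → i < n → P i) → count n P? ≡ n
  count-all n P? all = trans (sum-cong n (λ i i<n → ⟦⟧-yes (P? i) (all i i<n)))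
                             (trans (sum-const n 1) (ℕP.*-identityʳ n))

  count-none : {P : ℕ → Set} → ∀ n (P? : Decidable P) → (∀ i → i < n → ¬ P i) → count n P? ≡ 0
  count-none n P? none = trans (sum-cong n (λ i i<n → ⟦⟧-no (P? i) (none i i<n)))
                               (trans (sum-const n 0) (ℕP.*-zeroʳ n))

  count-¬ : {P : ℕ → Set} → ∀ n (P? : Decidable P) → count n (¬? ∘ P?) + count n P? ≡ n
  count-¬ n P? = trans (sym (sum-distrib-+ n _ _))
                       (trans (sum-cong n (λ i _ → ⟦¬⟧+⟦⟧ (P? i))) (trans (sum-const n 1) (ℕP.*-identityʳ n)))

  count-< : ∀ {k n} → k ≤ n → count n (ℕP._<? k) ≡ k
  count-< {zero}  {n}     _         = count-none n (ℕP._<? 0) (λ _ _ ())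
  count-< {suc k} {suc n} (s≤s k≤n) = cong suc (trans shift (count-< k≤n))
    where
    shift : count n (λ i → suc i ℕP.<? suc k) ≡ count n (ℕP._<? k)
    shift = count-cong n (λ i → suc i ℕP.<? suc k) (ℕP._<? k) (λ _ _ → mk⇔ s≤s⁻¹ s≤s)

  ⌈_/8⌉ : ℕ → ℕ
  ⌈ t /8⌉ = (t + 7) / 8

  8*<⇔<⌈/8⌉ : ∀ m t → 8 * m < t ⇔ m < ⌈ t /8⌉
  8*<⇔<⌈/8⌉ m t = mk⇔ to from
    where
    times8 : ∀ m → suc m * 8 ≡ suc (8 * m) + 7
    times8 = solve-∀
    to : 8 * m < t → m < ⌈ t /8⌉
    to 8m<t = subst (_≤ ⌈ t /8⌉) (m*n/n≡m (suc m) 8)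
                (/-monoˡ-≤ 8 (subst (_≤ t + 7) (sym (times8 m)) (ℕP.+-monoˡ-≤ 7 8m<t)))
    from : m < ⌈ t /8⌉ → 8 * m < t
    from m<⌈t/8⌉ = ℕP.+-cancelʳ-≤ 7 (suc (8 * m)) t
                     (subst (_≤ t + 7) (times8 m)
                       (ℕP.≤-trans (ℕP.*-monoˡ-≤ 8 m<⌈t/8⌉) (m/n*n≤m (t + 7) 8)))

  ⌈*8+/8⌉ : ∀ a b → ⌈ a * 8 + b /8⌉ ≡ a + ⌈ b /8⌉
  ⌈*8+/8⌉ a b = begin
    (a * 8 + b + 7) / 8       ≡⟨ cong (_/ 8) (regroup a b) ⟩
    (b + 7 + a * 8) / 8       ≡⟨ +-distrib-/-∣ʳ (b + 7) (n∣m*n a) ⟩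
    (b + 7) / 8 + a * 8 / 8   ≡⟨ cong ((b + 7) / 8 ℕ.+_) (m*n/n≡m a 8) ⟩
    (b + 7) / 8 + a           ≡⟨ ℕP.+-comm ((b + 7) / 8) a ⟩
    a + (b + 7) / 8           ∎
    where
    open ≡-Reasoning
    regroup : ∀ a b → a * 8 + b + 7 ≡ b + 7 + a * 8
    regroup = solve-∀

  count-8*< : ∀ n t → t ≤ 8 * n → count n (λ m → 8 * m ℕP.<? t) ≡ ⌈ t /8⌉
  count-8*< n t t≤8n =
    trans (count-cong n (λ m → 8 * m ℕP.<? t) (ℕP._<? ⌈ t /8⌉) (λ m _ → 8*<⇔<⌈/8⌉ m t)) (count-< ⌈t/8⌉≤n)
    where
    ⌈8n/8⌉≡n : ⌈ 8 * n /8⌉ ≡ n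
    ⌈8n/8⌉≡n = trans (cong ⌈_/8⌉ (trans (ℕP.*-comm 8 n) (sym (ℕP.+-identityʳ (n * 8)))))
                     (trans (⌈*8+/8⌉ n 0) (ℕP.+-identityʳ n))
    ⌈t/8⌉≤n : ⌈ t /8⌉ ≤ n
    ⌈t/8⌉≤n = subst (⌈ t /8⌉ ≤_) ⌈8n/8⌉≡n (/-monoˡ-≤ 8 (ℕP.+-monoˡ-≤ 7 t≤8n))

open Sums

-- Gauss's lemma

injective⇒surjective : ∀ {n} {f : Fin n → Fin n} → Injective _≡_ _≡_ f → ∀ y → ∃ λ x → f x ≡ y
injective⇒surjective {suc n} {f} f-injective y with any? (λ x → f x ≟ᶠ y)
... | yes hit  = hit
... | no  miss = contradiction (injective⇒≤ squeeze-injective) ℕP.1+n≰n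
  where
  y≢f : ∀ x → y ≢ f x
  y≢f x y≡fx = miss (x , sym y≡fx)
  squeeze : Fin (suc n) → Fin n
  squeeze x = punchOut (y≢f x)
  squeeze-injective : Injective _≡_ _≡_ squeeze
  squeeze-injective {x} {x′} eq = f-injective (punchOut-injective (y≢f x) (y≢f x′) eq)

injective⇒permutation : ∀ {n} (f : Fin n → Fin n) → Injective _≡_ _≡_ f → Permutation′ n
injective⇒permutation f f-injective =
  permutation f (proj₁ ∘ hit) (proj₂ ∘ hit) (λ x → f-injective (proj₂ (hit (f x))))
  where
  hit = injective⇒surjective f-injective

module Products (n : ℕ) where

  open Congruence n
  open import Algebra.Properties.CommutativeMonoid.Sum *-1-commutativeMonoid public
    using ()
    renaming (sum to ∏; ∑-distrib-+ to ∏-distrib-*; sum-cong-≋ to ∏-cong; sum-cong-≗ to ∏-cong-≡;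
              sum-permute to ∏-permute)

  ∏-const : ∀ m x → ∏ {m} (λ _ → x) ≡ x ℤ.^ m
  ∏-const zero    x = refl
  ∏-const (suc m) x = cong (x ℤ.*_) (∏-const m x)

  ∏-signs : ∀ {P : ℕ → Set} m (P? : Decidable P) →
            ∏ {m} (λ i → -1ℤ ℤ.^ ⟦ P? (toℕ i) ⟧) ≡ -1ℤ ℤ.^ count m P?
  ∏-signs zero    P? = refl
  ∏-signs (suc m) P? = trans (cong (-1ℤ ℤ.^ ⟦ P? 0 ⟧ ℤ.*_) (∏-signs m (P? ∘ suc)))
                             (sym (ℤP.^-distribˡ-+-* -1ℤ ⟦ P? 0 ⟧ (count m (P? ∘ suc))))

  module _ (n-prime : Prime n) where

    ∤-∏ : ∀ {m} (f : Fin m → ℤ) → (∀ i → ¬ (+ n ∣ f i)) → ¬ (+ n ∣ ∏ f)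
    ∤-∏ {zero}  f _    n∣1 = ∤-small (s≤s z≤n) (ℕ.nonTrivial⇒n>1 n {{prime⇒nonTrivial n-prime}}) n∣1
    ∤-∏ {suc m} f n∤fi = ∤-* n-prime (n∤fi Fin.zero) (∤-∏ (f ∘ Fin.suc) (n∤fi ∘ Fin.suc))

module Gauss (p H : ℕ) (p≡ : p ≡ suc (2 ℕ.* H)) (p-prime : Prime p) where

  open Congruence p
  open Products p
  open import Data.Integer using (_+_; _-_; _*_; -_; _^_)

  instance
    p-nonZero : NonZero p
    p-nonZero = prime⇒nonZero p-prime

  p≡H+1+H : p ≡ H ℕ.+ suc H
  p≡H+1+H = trans p≡ (trans (cong (λ h → suc (H ℕ.+ h)) (ℕP.+-identityʳ H)) (sym (ℕP.+-suc H H)))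

  ≤H⇒<p : ∀ {k} → k ℕ.≤ H → k ℕ.< p
  ≤H⇒<p k≤H = ℕP.≤-<-trans k≤H (subst (H ℕ.<_) (sym p≡H+1+H) (ℕP.m<m+n H (s≤s z≤n)))

  fold : ℕ → ℕ
  fold r = if does (H ℕP.<? r) then p ℕ.∸ r else r

  fold-≈ : ∀ {r} → r ℕ.≤ p → + r ≈ -1ℤ ^ ⟦ H ℕP.<? r ⟧ * + fold r
  fold-≈ {r} r≤p = by-cases (H ℕP.<? r)
    where
    negate : ∀ P R → -1ℤ * (P - R) ≡ R + -1ℤ * P
    negate = ℤ-Solver.solve-∀
    reflection : -1ℤ * + (p ℕ.∸ r) ≡ + r + -1ℤ * + p
    reflection = trans (cong (-1ℤ *_) (sym (trans (ℤP.m-n≡m⊖n p r) (ℤP.⊖-≥ r≤p)))) (negate (+ p) (+ r))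
    by-cases : (H<r? : Dec (H ℕ.< r)) → + r ≈ -1ℤ ^ ⟦ H<r? ⟧ * + (if does H<r? then p ℕ.∸ r else r)
    by-cases (yes _) = ≈-sym (subst (_≈ + r) (sym reflection) (+-multiple (+ r) -1ℤ))
    by-cases (no  _) = ≈-reflexive (sym (ℤP.*-identityˡ (+ r)))

  fold-bounds : ∀ {r} → 0 ℕ.< r → r ℕ.< p → 0 ℕ.< fold r × fold r ℕ.≤ H
  fold-bounds {r} 0<r r<p = by-cases (H ℕP.<? r)
    where
    by-cases : (H<r? : Dec (H ℕ.< r)) →
               let f = if does H<r? then p ℕ.∸ r else r in 0 ℕ.< f × f ℕ.≤ H
    by-cases (yes H<r) =
      ℕP.m<n⇒0<n∸m r<p , subst (p ℕ.∸ r ℕ.≤_) (ℕP.m+n∸n≡m H r) (ℕP.∸-monoˡ-≤ r p≤H+r)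
      where
      p≤H+r : p ℕ.≤ H ℕ.+ r
      p≤H+r = subst (ℕ._≤ H ℕ.+ r) (sym p≡H+1+H) (ℕP.+-monoʳ-≤ H H<r)
    by-cases (no ¬H<r) = 0<r , ℕP.≮⇒≥ ¬H<r

  fold-injective : ∀ {x y} → x ℕ.< p → y ℕ.< p → fold x ≡ fold y → x ≡ y ⊎ x ℕ.+ y ≡ p
  fold-injective {x} {y} x<p y<p = by-cases (H ℕP.<? x) (H ℕP.<? y)
    where
    x≤p = ℕP.<⇒≤ x<p
    y≤p = ℕP.<⇒≤ y<p
    by-cases : (H<x? : Dec (H ℕ.< x)) (H<y? : Dec (H ℕ.< y)) →
               (if does H<x? then p ℕ.∸ x else x) ≡ (if does H<y? then p ℕ.∸ y else y) →
               x ≡ y ⊎ x ℕ.+ y ≡ p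
    by-cases (yes _) (yes _) eq = inj₁ (ℕP.∸-cancelˡ-≡ x≤p y≤p eq)
    by-cases (yes _) (no  _) eq = inj₂ (trans (cong (x ℕ.+_) (sym eq)) (ℕP.m+[n∸m]≡n x≤p))
    by-cases (no  _) (yes _) eq = inj₂ (trans (cong (ℕ._+ y) eq) (ℕP.m∸n+n≡m y≤p))
    by-cases (no  _) (no  _) eq = inj₁ eq

  μ : ℕ → ℕ
  μ a = count H (λ i → H ℕP.<? suc i ℕ.* a % p)

  module _ (a : ℕ) (p∤a : ¬ (+ p ∣ + a)) where

    residue : ℕ → ℕ
    residue k = k ℕ.* a % p

    sign : ℕ → ℤ
    sign k = -1ℤ ^ ⟦ H ℕP.<? residue k ⟧

    t : ℕ → ℕ
    t k = fold (residue k)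

    residue<p : ∀ k → residue k ℕ.< p
    residue<p k = m%n<n (k ℕ.* a) p

    residue-≈ : ∀ k → + k * + a ≈ + residue k
    residue-≈ k = ≈-trans (≈-reflexive (sym (ℤP.pos-* k a))) (≈-% (k ℕ.* a))

    multiple-≈ : ∀ k → + k * + a ≈ sign k * + t k
    multiple-≈ k = ≈-trans (residue-≈ k) (fold-≈ (ℕP.<⇒≤ (residue<p k)))

    residue-pos : ∀ {k} → 0 ℕ.< k → k ℕ.< p → 0 ℕ.< residue k
    residue-pos {k} 0<k k<p = ℕP.n≢0⇒n>0 λ r≡0 →
      ∤-* p-prime (∤-small 0<k k<p) p∤a (≈0⇒∣ (subst (λ r → + k * + a ≈ + r) r≡0 (residue-≈ k)))

    t-bounds : ∀ {k} → 0 ℕ.< k → k ℕ.< p → 0 ℕ.< t k × t k ℕ.≤ H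
    t-bounds {k} 0<k k<p = fold-bounds (residue-pos {k} 0<k k<p) (residue<p k)

    t-injective : ∀ {j k} → 0 ℕ.< j → j ℕ.≤ H → 0 ℕ.< k → k ℕ.≤ H → t j ≡ t k → j ≡ k
    t-injective {j} {k} 0<j j≤H 0<k k≤H tj≡tk with fold-injective (residue<p j) (residue<p k) tj≡tk
    ... | inj₁ rj≡rk = ≈⇒≡ (≤H⇒<p j≤H) (≤H⇒<p k≤H) (*-cancelʳ-≈ p-prime (+ a) p∤a (begin
          + j * + a     ≈⟨ residue-≈ j ⟩
          + residue j   ≡⟨ cong +_ rj≡rk ⟩
          + residue k   ≈⟨ residue-≈ k ⟨
          + k * + a     ∎))
      where open ≈-Reasoning
    ... | inj₂ rj+rk≡p = ⊥-elim (∤-small 0<j+k j+k<p (≈0⇒∣ (*-cancelʳ-≈ p-prime (+ a) p∤a (begin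
          + (j ℕ.+ k) * + a               ≡⟨ cong (_* + a) (ℤP.pos-+ j k) ⟩
          (+ j + + k) * + a               ≡⟨ ℤP.*-distribʳ-+ (+ a) (+ j) (+ k) ⟩
          + j * + a + + k * + a           ≈⟨ +-cong (residue-≈ j) (residue-≈ k) ⟩
          + residue j + + residue k       ≡⟨ sym (ℤP.pos-+ (residue j) (residue k)) ⟩
          + (residue j ℕ.+ residue k)     ≡⟨ cong +_ rj+rk≡p ⟩
          + p                             ≈⟨ n≈0 ⟩
          0ℤ                              ≡⟨ sym (ℤP.*-zeroˡ (+ a)) ⟩
          0ℤ * + a                        ∎))))
      where
      open ≈-Reasoning
      0<j+k : 0 ℕ.< j ℕ.+ k
      0<j+k = ℕP.<-≤-trans 0<j (ℕP.m≤m+n j k)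
      j+k<p : j ℕ.+ k ℕ.< p
      j+k<p = subst (j ℕ.+ k ℕ.<_) (sym p≡H+1+H) (ℕP.+-mono-≤-< j≤H (s≤s k≤H))

    private
      pred-< : ∀ {m} → 0 ℕ.< m → m ℕ.≤ H → ℕ.pred m ℕ.< H
      pred-< {suc m} _ m<H = m<H

      suc-pred : ∀ {m} → 0 ℕ.< m → suc (ℕ.pred m) ≡ m
      suc-pred {suc m} _ = refl

      t-in-range : (i : Fin H) → 0 ℕ.< t (suc (toℕ i)) × t (suc (toℕ i)) ℕ.≤ H
      t-in-range i = t-bounds (s≤s z≤n) (≤H⇒<p (toℕ<n i))

    τ : Fin H → Fin H
    τ i = fromℕ< (pred-< (proj₁ (t-in-range i)) (proj₂ (t-in-range i)))

    suc-τ : ∀ i → suc (toℕ (τ i)) ≡ t (suc (toℕ i))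
    suc-τ i = trans (cong suc (toℕ-fromℕ< _)) (suc-pred (proj₁ (t-in-range i)))

    τ-injective : Injective _≡_ _≡_ τ
    τ-injective {i} {j} τi≡τj = toℕ-injective (ℕP.suc-injective
      (t-injective (s≤s z≤n) (toℕ<n i) (s≤s z≤n) (toℕ<n j)
        (trans (sym (suc-τ i)) (trans (cong (suc ∘ toℕ) τi≡τj) (suc-τ j)))))

    -- Multiply by H! = ∏ F: the k a with 1 ≤ k ≤ H are, up to sign, a permutation of 1, …, H.
    gauss-lemma : (+ a) ^ H ≈ -1ℤ ^ μ a
    gauss-lemma = *-cancelʳ-≈ p-prime (∏ F) p∤H! (begin
      (+ a) ^ H * ∏ F                          ≡⟨ cong (_* ∏ F) (∏-const H (+ a)) ⟨
      ∏ {H} (λ _ → + a) * ∏ F                  ≈⟨ ∏-distrib-* {H} (λ _ → + a) F ⟨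
      ∏ {H} (λ i → + a * F i)                  ≈⟨ ∏-cong {H} factors ⟩
      ∏ {H} (λ i → ε i * T i)                  ≈⟨ ∏-distrib-* {H} ε T ⟩
      ∏ {H} ε * ∏ {H} T                        ≡⟨ cong₂ _*_ (∏-signs H (λ i → H ℕP.<? residue (suc i)))
                                                            (∏-cong-≡ {H} (λ i → cong +_ (sym (suc-τ i)))) ⟩
      -1ℤ ^ μ a * ∏ (F ∘ τ)                    ≈⟨ *-cong (≈-refl { -1ℤ ^ μ a}) (∏-permute F π) ⟨
      -1ℤ ^ μ a * ∏ F                          ∎)
      where
      open ≈-Reasoning
      F ε T : Fin H → ℤ
      F i = + suc (toℕ i)
      ε i = sign (suc (toℕ i))
      T i = + t (suc (toℕ i))
      factors : ∀ i → + a * F i ≈ ε i * T i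
      factors i = ≈-trans (≈-reflexive (ℤP.*-comm (+ a) (F i))) (multiple-≈ (suc (toℕ i)))
      π = injective⇒permutation τ τ-injective
      p∤H! : ¬ (+ p ∣ ∏ F)
      p∤H! = ∤-∏ p-prime F (λ i → ∤-small (s≤s z≤n) (≤H⇒<p (toℕ<n i)))

  fermat : ∀ a → ¬ (+ p ∣ + a) → (+ a) ^ (2 ℕ.* H) ≈ 1ℤ
  fermat a p∤a = begin
    (+ a) ^ (2 ℕ.* H)    ≡⟨ cong ((+ a) ^_) (ℕP.*-comm 2 H) ⟩
    (+ a) ^ (H ℕ.* 2)    ≡⟨ ℤP.^-*-assoc (+ a) H 2 ⟨
    ((+ a) ^ H) ^ 2      ≈⟨ ^-cong 2 (gauss-lemma a p∤a) ⟩
    (-1ℤ ^ μ a) ^ 2      ≡⟨ ℤP.^-*-assoc -1ℤ (μ a) 2 ⟩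
    -1ℤ ^ (μ a ℕ.* 2)    ≡⟨ cong (-1ℤ ^_) (ℕP.*-comm (μ a) 2) ⟩
    -1ℤ ^ (2 ℕ.* μ a)    ≡⟨ -1^[2*m]≡1 (μ a) ⟩
    1ℤ                   ∎
    where open ≈-Reasoning

-- Primitive roots and the cosets C_i^4

module QuarticCosets (p Q : ℕ) (p≡ : p ≡ suc (4 ℕ.* Q)) (p-prime : Prime p) where

  open Congruence p
  open import Data.Integer using (_*_; _^_)

  0<Q : 0 ℕ.< Q
  0<Q = ℕP.n≢0⇒n>0 λ Q≡0 → ℕP.<-irrefl refl (subst (1 ℕ.<_) (trans p≡ (cong (λ q → suc (4 ℕ.* q)) Q≡0)) 1<p)
    where
    1<p : 1 ℕ.< p
    1<p = ℕ.nonTrivial⇒n>1 p {{prime⇒nonTrivial p-prime}}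

  instance
    p-nonZero : NonZero p
    p-nonZero = prime⇒nonZero p-prime
    Q-nonZero : NonZero Q
    Q-nonZero = ℕ.>-nonZero 0<Q
    4Q-nonZero : NonZero (4 ℕ.* Q)
    4Q-nonZero = ℕ.>-nonZero (ℕP.*-monoʳ-< 4 0<Q)

  open Gauss p (2 ℕ.* Q) (trans p≡ (cong suc (ℕP.*-assoc 2 2 Q))) p-prime using (μ; gauss-lemma; fermat)

  <4Q⇒<p : ∀ {x} → x ℕ.< 4 ℕ.* Q → suc x ℕ.< p
  <4Q⇒<p x<4Q = subst (ℕ._<_ _) (sym p≡) (s≤s x<4Q)

  2<p : 2 ℕ.< p
  2<p = <4Q⇒<p (ℕP.<-≤-trans (s≤s (s≤s z≤n)) (ℕP.m≤m*n 4 Q))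

  2^Q≈-1^μ : ∀ q → (+ q) ^ 2 ≈ + 8 → ¬ (+ p ∣ + q) → (+ 2) ^ Q ≈ -1ℤ ^ μ q
  2^Q≈-1^μ q q²≈8 p∤q = begin
    (+ 2) ^ Q                            ≡⟨ ℤP.*-identityʳ _ ⟨
    (+ 2) ^ Q * 1ℤ                       ≡⟨ cong ((+ 2) ^ Q *_) ε²≡1 ⟨
    (+ 2) ^ Q * (ε * ε)                  ≈⟨ *-cong (≈-refl {(+ 2) ^ Q}) (*-cong 2^3Q≈ε (≈-refl {ε})) ⟨
    (+ 2) ^ Q * ((+ 2) ^ (3 ℕ.* Q) * ε)  ≡⟨ ℤP.*-assoc ((+ 2) ^ Q) _ ε ⟨
    (+ 2) ^ Q * (+ 2) ^ (3 ℕ.* Q) * ε    ≡⟨ cong (_* ε) (ℤP.^-distribˡ-+-* (+ 2) Q (3 ℕ.* Q)) ⟨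
    (+ 2) ^ (Q ℕ.+ 3 ℕ.* Q) * ε          ≡⟨ cong (λ e → (+ 2) ^ e * ε) (four-quarters Q) ⟩
    (+ 2) ^ (2 ℕ.* (2 ℕ.* Q)) * ε        ≈⟨ *-cong (fermat 2 (∤-small (s≤s z≤n) 2<p)) (≈-refl {ε}) ⟩
    1ℤ * ε                               ≡⟨ ℤP.*-identityˡ ε ⟩
    ε                                    ∎
    where
    open ≈-Reasoning
    ε : ℤ
    ε = -1ℤ ^ μ q
    ε²≡1 : ε * ε ≡ 1ℤ
    ε²≡1 = trans (sym (ℤP.^-distribˡ-+-* -1ℤ (μ q) (μ q)))
                 (trans (cong (λ m → -1ℤ ^ (μ q ℕ.+ m)) (sym (ℕP.+-identityʳ (μ q)))) (-1^[2*m]≡1 (μ q)))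
    2^3Q≈ε : (+ 2) ^ (3 ℕ.* Q) ≈ ε
    2^3Q≈ε = begin
      (+ 2) ^ (3 ℕ.* Q)   ≡⟨ ℤP.^-*-assoc (+ 2) 3 Q ⟨
      (+ 8) ^ Q           ≈⟨ ^-cong Q q²≈8 ⟨
      ((+ q) ^ 2) ^ Q     ≡⟨ ℤP.^-*-assoc (+ q) 2 Q ⟩
      (+ q) ^ (2 ℕ.* Q)   ≈⟨ gauss-lemma q p∤q ⟩
      ε                   ∎
    four-quarters : ∀ Q → Q ℕ.+ 3 ℕ.* Q ≡ 2 ℕ.* (2 ℕ.* Q)
    four-quarters = ℕ-Solver.solve-∀

  module _ (α : ℕ) (α-primitive : Primitive p α) where

    private
      A : ℤ
      A = + α

    ∤α : ¬ (+ p ∣ + α)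
    ∤α p∣α = proj₁ α-primitive (≈⇒ModEq (∣⇒≈0 p∣α))

    α^4Q≈1 : A ^ (4 ℕ.* Q) ≈ 1ℤ
    α^4Q≈1 = subst (λ e → A ^ e ≈ 1ℤ) (sym (ℕP.*-assoc 2 2 Q)) (fermat α ∤α)

    discrete-log : ∀ x → 1 ℕ.≤ x → x ℕ.< p → ∃ λ k → A ^ k ≈ + x
    discrete-log x 1≤x x<p with proj₂ α-primitive x 1≤x x<p
    ... | k , αᵏ≡x = k , subst (_≈ + x) (pos-^ α k) (ModEq⇒≈ αᵏ≡x)

    order : ∀ {d} → 0 ℕ.< d → d ℕ.< 4 ℕ.* Q → ¬ (A ^ d ≈ 1ℤ)
    order {d} 0<d d<4Q αᵈ≈1 = ℕP.<⇒≱ d<4Q (injective⇒≤ {f = class} class-injective)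
      where
      instance
        d-nonZero : NonZero d
        d-nonZero = ℕ.>-nonZero 0<d
      log : Fin (4 ℕ.* Q) → ℕ
      log i = proj₁ (discrete-log (suc (toℕ i)) (s≤s z≤n) (<4Q⇒<p (toℕ<n i)))
      log-≈ : ∀ i → A ^ (log i % d) ≈ + suc (toℕ i)
      log-≈ i = ≈-trans (≈-sym (^-%-≈ d αᵈ≈1 (log i)))
                        (proj₂ (discrete-log (suc (toℕ i)) (s≤s z≤n) (<4Q⇒<p (toℕ<n i))))
      class : Fin (4 ℕ.* Q) → Fin d
      class i = fromℕ< (m%n<n (log i) d)
      class-injective : ∀ {i j} → class i ≡ class j → i ≡ j
      class-injective {i} {j} eq = toℕ-injective (ℕP.suc-injective (≈⇒≡ (<4Q⇒<p (toℕ<n i)) (<4Q⇒<p (toℕ<n j))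
        (≈-trans (≈-sym (log-≈ i)) (≈-trans (≈-reflexive (cong (A ^_) same-class)) (log-≈ j)))))
        where
        same-class : log i % d ≡ log j % d
        same-class = trans (sym (toℕ-fromℕ< _)) (trans (cong toℕ eq) (toℕ-fromℕ< _))

    private
      distinct-powers : ∀ {j k} → j ℕ.< k → k ℕ.< 4 ℕ.* Q → ¬ (A ^ j ≈ A ^ k)
      distinct-powers {j} {k} j<k k<4Q αʲ≈αᵏ =
        order (ℕP.m<n⇒0<n∸m j<k) (ℕP.≤-<-trans (ℕP.m∸n≤m k j) k<4Q)
          (*-cancelʳ-≈ p-prime (A ^ j) (∤-^ p-prime ∤α j) (begin
            A ^ (k ℕ.∸ j) * A ^ j  ≡⟨ ℤP.^-distribˡ-+-* A (k ℕ.∸ j) j ⟨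
            A ^ (k ℕ.∸ j ℕ.+ j)    ≡⟨ cong (A ^_) (ℕP.m∸n+n≡m (ℕP.<⇒≤ j<k)) ⟩
            A ^ k                  ≈⟨ αʲ≈αᵏ ⟨
            A ^ j                  ≡⟨ ℤP.*-identityˡ (A ^ j) ⟨
            1ℤ * A ^ j             ∎))
        where open ≈-Reasoning

    ^-injective : ∀ {j k} → j ℕ.< 4 ℕ.* Q → k ℕ.< 4 ℕ.* Q → A ^ j ≈ A ^ k → j ≡ k
    ^-injective {j} {k} j<4Q k<4Q αʲ≈αᵏ with ℕP.<-cmp j k
    ... | tri< j<k _ _ = ⊥-elim (distinct-powers j<k k<4Q αʲ≈αᵏ)
    ... | tri≈ _ j≡k _ = j≡k
    ... | tri> _ _ k<j = ⊥-elim (distinct-powers k<j j<4Q (≈-sym αʲ≈αᵏ))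

    ^-≈⇒%≡ : ∀ {j k} → A ^ j ≈ A ^ k → j % (4 ℕ.* Q) ≡ k % (4 ℕ.* Q)
    ^-≈⇒%≡ {j} {k} αʲ≈αᵏ = ^-injective (m%n<n j _) (m%n<n k _)
      (≈-trans (≈-sym (^-%-≈ (4 ℕ.* Q) α^4Q≈1 j)) (≈-trans αʲ≈αᵏ (^-%-≈ (4 ℕ.* Q) α^4Q≈1 k)))

    α^2Q≈-1 : A ^ (2 ℕ.* Q) ≈ -1ℤ
    α^2Q≈-1 with square-root-of-1 p-prime α^2Q²≈1
      where
      double : ∀ Q → 2 ℕ.* Q ℕ.+ 2 ℕ.* Q ≡ 4 ℕ.* Q
      double = ℕ-Solver.solve-∀
      α^2Q²≈1 : A ^ (2 ℕ.* Q) * A ^ (2 ℕ.* Q) ≈ 1ℤ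
      α^2Q²≈1 = subst (_≈ 1ℤ) (trans (cong (A ^_) (sym (double Q))) (ℤP.^-distribˡ-+-* A (2 ℕ.* Q) (2 ℕ.* Q)))
                      α^4Q≈1
    ... | inj₁ α^2Q≈1  = ⊥-elim (order (ℕP.*-monoʳ-< 2 0<Q) (ℕP.*-monoˡ-< Q {2} {4} (s≤s (s≤s (s≤s z≤n)))) α^2Q≈1)
    ... | inj₂ α^2Q≈-1 = α^2Q≈-1

    coset-by-power : ∀ {x} i → 1 ℕ.≤ x → x ℕ.< p → i ℕ.< 4 → (+ x) ^ Q ≈ A ^ (i ℕ.* Q) →
                     InCoset4 p α i x
    coset-by-power {x} i 1≤x x<p i<4 xᵠ≈αⁱᵠ with proj₂ α-primitive x 1≤x x<p
    ... | k , αᵏ≡x = k / 4 , subst (λ e → ModEq p (α ℕ.^ e) x) k≡4[k/4]+i αᵏ≡x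
      where
      αᵏᵠ≈αⁱᵠ : A ^ (k ℕ.* Q) ≈ A ^ (i ℕ.* Q)
      αᵏᵠ≈αⁱᵠ = ≈-trans (≈-reflexive (sym (ℤP.^-*-assoc A k Q)))
                  (≈-trans (^-cong Q (subst (_≈ + x) (pos-^ α k) (ModEq⇒≈ αᵏ≡x))) xᵠ≈αⁱᵠ)
      k%4≡i : k % 4 ≡ i
      k%4≡i = ℕP.*-cancelʳ-≡ (k % 4) i Q (begin
        k % 4 ℕ.* Q                ≡⟨ m%n*o≡m*o%[n*o] k 4 Q ⟩
        k ℕ.* Q % (4 ℕ.* Q)        ≡⟨ ^-≈⇒%≡ αᵏᵠ≈αⁱᵠ ⟩
        i ℕ.* Q % (4 ℕ.* Q)        ≡⟨ m%n*o≡m*o%[n*o] i 4 Q ⟨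
        i % 4 ℕ.* Q                ≡⟨ cong (ℕ._* Q) (m<n⇒m%n≡m i<4) ⟩
        i ℕ.* Q                    ∎)
        where open ≡-Reasoning
      k≡4[k/4]+i : k ≡ 4 ℕ.* (k / 4) ℕ.+ i
      k≡4[k/4]+i = trans (m≡m%n+[m/n]*n k 4)
                         (trans (ℕP.+-comm (k % 4) _) (cong₂ ℕ._+_ (ℕP.*-comm (k / 4) 4) k%4≡i))

-- Gauss's count for q = 2g + 7 modulo q² − 8

module Counting where

  open import Data.Nat.Base using (_+_; _*_; _∸_; _≤_; _<_)
  open import Data.Nat.DivMod using (m%n≤m)
  open import Data.Nat.Properties
  open import Data.Nat.Tactic.RingSolver using (solve-∀; solve)

  module _ {H p : ℕ} .{{_ : NonZero p}} where

    ≤⇒¬<% : ∀ {X} → X ≤ H → ¬ (H < X % p)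
    ≤⇒¬<% {X} X≤H H<X%p = <⇒≱ H<X%p (≤-trans (m%n≤m X p) X≤H)

    <⇒<% : ∀ {X} → H < X → X < p → H < X % p
    <⇒<% {X} H<X X<p = subst (H <_) (sym (m<n⇒m%n≡m X<p)) H<X

    <%⇔≮ : ∀ {S A L} → S + A < p → suc H ≡ S + L → H < (S + A) % p ⇔ (¬ A < L)
    <%⇔≮ {S} {A} {L} X<p H+1≡S+L = mk⇔ to from
      where
      to : H < (S + A) % p → ¬ A < L
      to H<X%p A<L = <⇒≱ (+-monoʳ-< S A<L) (subst (_≤ S + A) H+1≡S+L (subst (H <_) (m<n⇒m%n≡m X<p) H<X%p))
      from : ¬ (A < L) → H < (S + A) % p
      from A≮L = <⇒<% (subst (_≤ S + A) (sym H+1≡S+L) (+-monoʳ-≤ S (≮⇒≥ A≮L))) X<p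

    -- X = S + A − c stays below p exactly when A < T; otherwise its residue is A − T ≤ H.
    <%⇔<-wrapping : ∀ {X S A T} c → X + c ≡ S + A → p + c ≡ S + T → H + c ≤ S → 0 < A → A ≤ T + H →
                    H < X % p ⇔ A < T
    <%⇔<-wrapping {X} {S} {A} {T} c X+c≡S+A p+c≡S+T H+c≤S 0<A A≤T+H = mk⇔ to from
      where
      from : A < T → H < X % p
      from A<T = <⇒<% (+-cancelʳ-< c H X (≤-<-trans H+c≤S (subst (S <_) (sym X+c≡S+A) (m<m+n S 0<A))))
                      (+-cancelʳ-< c X p (subst₂ _<_ (sym X+c≡S+A) (sym p+c≡S+T) (+-monoʳ-< S A<T)))
      to : H < X % p → A < T
      to H<X%p with A <? T
      ... | yes A<T = A<T
      ... | no  A≮T = contradiction X%p≤H (<⇒≱ H<X%p)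
        where
        T≤A = ≮⇒≥ A≮T
        X≡ : X ≡ (A ∸ T) + 1 * p
        X≡ = +-cancelʳ-≡ c X _ (begin
          X + c                ≡⟨ X+c≡S+A ⟩
          S + A                ≡⟨ cong (λ z → S + z) (sym (m∸n+n≡m T≤A)) ⟩
          S + (A ∸ T + T)      ≡⟨ regroup S (A ∸ T) T ⟩
          A ∸ T + (S + T)      ≡⟨ cong (λ z → A ∸ T + z) (sym p+c≡S+T) ⟩
          A ∸ T + (p + c)      ≡⟨ regroup′ (A ∸ T) p c ⟩
          A ∸ T + 1 * p + c    ∎)
          where
          open ≡-Reasoning
          regroup : ∀ S D T → S + (D + T) ≡ D + (S + T)
          regroup = solve-∀
          regroup′ : ∀ D p c → D + (p + c) ≡ D + 1 * p + c
          regroup′ = solve-∀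
        X%p≡ : X % p ≡ (A ∸ T) % p
        X%p≡ = trans (cong (_% p) X≡) ([m+kn]%n≡m%n (A ∸ T) 1 p)
        A∸T≤H : A ∸ T ≤ H
        A∸T≤H = subst (A ∸ T ≤_) (m+n∸m≡n T H) (∸-monoˡ-≤ T A≤T+H)
        X%p≤H : X % p ≤ H
        X%p≤H = ≤-trans (≤-reflexive X%p≡) (≤-trans (m%n≤m (A ∸ T) p) A∸T≤H)

  -- g stands for u − 2, so that q = 2u + 3 = 2g + 7 and p = 4u² + 12u + 1 = q² − 8 = 4Q + 1 need no
  -- truncated subtraction.  The values 0 ≤ k ≤ H = 2Q fill g + 3 blocks k = m q + r (r < q) and g more.
  module GaussCount (g : ℕ) where

    Q H p q : ℕ
    Q = g * g + 7 * g + 10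
    H = 2 * Q
    p = suc (4 * Q)
    q = 2 * g + 7

    μ : ℕ
    μ = count H (λ i → H <? suc i * q % p)

    residue : ℕ → ℕ → ℕ
    residue r m = (r * q + 8 * m) % p

    residue-of-multiple : ∀ m r → (m * q + r) * q % p ≡ residue r m
    residue-of-multiple m r = trans (cong (_% p) q²≡p+8) ([m+kn]%n≡m%n (r * q + 8 * m) m p)
      where
      q²≡p+8 : (m * (2 * g + 7) + r) * (2 * g + 7) ≡ (r * (2 * g + 7) + 8 * m) + m * suc (4 * (g * g + 7 * g + 10))
      q²≡p+8 = solve (m ∷ r ∷ g ∷ [])

    block-start : ∀ {r m} → r < g → m ≤ g + 3 → ¬ H < residue r m
    block-start {r} {m} r<g m≤g+3 = ≤⇒¬<% (+-cancelʳ-≤ q (r * q + 8 * m) H (begin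
        r * q + 8 * m + q       ≡⟨ regroup ⟩
        suc r * q + 8 * m       ≤⟨ +-mono-≤ (*-monoˡ-≤ q r<g) (*-monoʳ-≤ 8 m≤g+3) ⟩
        g * q + 8 * (g + 3)     ≤⟨ m+n≤o⇒m≤o _ (≤-reflexive slack) ⟩
        H + q                   ∎))
      where
      open ≤-Reasoning
      regroup : r * (2 * g + 7) + 8 * m + (2 * g + 7) ≡ suc r * (2 * g + 7) + 8 * m
      regroup = solve (r ∷ m ∷ g ∷ [])
      slack : g * (2 * g + 7) + 8 * (g + 3) + (g + 3) ≡ 2 * (g * g + 7 * g + 10) + (2 * g + 7)
      slack = solve (g ∷ [])

    block-lower-cut : ∀ {m} j i → j + i ≡ 3 → m ≤ g + 2 → H < residue (g + j) m ⇔ (¬ 8 * m < i * q + g)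
    block-lower-cut {m} j i j+i≡3 m≤g+2 = <%⇔≮ {S = (g + j) * q} X<p (begin
        suc H                        ≡⟨ H+1≡ ⟩
        (g + 3) * q + g              ≡⟨ cong (λ n → (g + n) * q + g) (sym j+i≡3) ⟩
        (g + (j + i)) * q + g        ≡⟨ regroup ⟩
        (g + j) * q + (i * q + g)    ∎)
      where
      open ≡-Reasoning
      H+1≡ : suc (2 * (g * g + 7 * g + 10)) ≡ (g + 3) * (2 * g + 7) + g
      H+1≡ = solve (g ∷ [])
      regroup : (g + (j + i)) * (2 * g + 7) + g ≡ (g + j) * (2 * g + 7) + (i * (2 * g + 7) + g)
      regroup = solve (g ∷ j ∷ i ∷ [])
      slack : suc ((g + 3) * (2 * g + 7) + 8 * (g + 2)) + (2 * (g * g) + 7 * g + 3) ≡ suc (4 * (g * g + 7 * g + 10))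
      slack = solve (g ∷ [])
      X<p : (g + j) * q + 8 * m < p
      r≤g+3 : g + j ≤ g + 3
      r≤g+3 = +-monoʳ-≤ g (m+n≤o⇒m≤o _ (≤-reflexive j+i≡3))
      X<p = ≤-trans (s≤s (+-mono-≤ (*-monoˡ-≤ q r≤g+3) (*-monoʳ-≤ 8 m≤g+2)))
                    (m+n≤o⇒m≤o _ (≤-reflexive slack))

    block-middle : ∀ {m} j → j < g → m ≤ g + 2 → H < residue (g + (4 + j)) m
    block-middle {m} j j<g m≤g+2 = <⇒<% H<X X<p
      where
      r = g + (4 + j)
      below : suc (2 * (g * g + 7 * g + 10)) + (g + 7) ≡ (g + 4) * (2 * g + 7)
      below = solve (g ∷ [])
      H<X : H < r * q + 8 * m
      H<X = ≤-trans (m+n≤o⇒m≤o _ (≤-reflexive below))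
              (≤-trans (*-monoˡ-≤ q (+-monoʳ-≤ g (m≤m+n 4 j))) (m≤m+n (r * q) (8 * m)))
      above : suc ((g + (3 + g)) * (2 * g + 7) + 8 * (g + 2)) + 3 ≡ suc (4 * (g * g + 7 * g + 10))
      above = solve (g ∷ [])
      X<p : r * q + 8 * m < p
      X<p = ≤-trans (s≤s (+-mono-≤ (*-monoˡ-≤ q (+-monoʳ-≤ g (+-monoʳ-≤ 3 j<g))) (*-monoʳ-≤ 8 m≤g+2)))
                    (m+n≤o⇒m≤o _ (≤-reflexive above))

    block-upper-cut : ∀ {m} j i → j + i ≡ 3 → 0 < i → m ≤ g + 2 →
                      H < residue (g + (4 + (g + j))) m ⇔ 8 * suc m < i * q
    block-upper-cut {m} j i j+i≡3 0<i m≤g+2 =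
      <%⇔<-wrapping {S = r * q} 8 (shift (r * q) m) p+8≡ H+8≤S (s≤s z≤n) A≤T+H
      where
      r = g + (4 + (g + j))
      shift : ∀ s m → s + 8 * m + 8 ≡ s + 8 * suc m
      shift = solve-∀
      p+8≡ : p + 8 ≡ r * q + i * q
      p+8≡ = begin
        p + 8                              ≡⟨ q² ⟩
        (g + (4 + (g + 3))) * q            ≡⟨ cong (λ n → (g + (4 + (g + n))) * q) (sym j+i≡3) ⟩
        (g + (4 + (g + (j + i)))) * q      ≡⟨ split ⟩
        r * q + i * q                      ∎
        where
        open ≡-Reasoning
        q² : suc (4 * (g * g + 7 * g + 10)) + 8 ≡ (g + (4 + (g + 3))) * (2 * g + 7)
        q² = solve (g ∷ [])
        split : (g + (4 + (g + (j + i)))) * (2 * g + 7) ≡ (g + (4 + (g + j))) * (2 * g + 7) + i * (2 * g + 7)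
        split = solve (g ∷ j ∷ i ∷ [])
      wide : 2 * (g * g + 7 * g + 10) + 8 + (2 * (g * g) + 8 * g) ≡ (g + (4 + g)) * (2 * g + 7)
      wide = solve (g ∷ [])
      H+8≤S : H + 8 ≤ r * q
      H+8≤S = ≤-trans (m+n≤o⇒m≤o _ (≤-reflexive wide))
                      (*-monoˡ-≤ q (+-monoʳ-≤ g (+-monoʳ-≤ 4 (m≤m+n g j))))
      tall : 8 * (g + 3) + (2 * (g * g) + 8 * g + 3) ≡ (2 * g + 7) + 2 * (g * g + 7 * g + 10)
      tall = solve (g ∷ [])
      A≤T+H : 8 * suc m ≤ i * q + H
      A≤T+H = ≤-trans (*-monoʳ-≤ 8 (subst (suc m ≤_) (sym (+-suc g 2)) (s≤s m≤g+2)))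
                (≤-trans (m+n≤o⇒m≤o _ (≤-reflexive tall))
                         (+-monoˡ-≤ H (subst (_≤ i * q) (*-identityˡ q) (*-monoˡ-≤ q 0<i))))

    -- In block m ≤ g + 2 the residue of r q + 8 m is at most H for r < g and lies in (H, p) for
    -- g + 4 ≤ r ≤ 2g + 3; the positions r = g + 3 − i (i < 4) and r = 2g + 7 − i (1 ≤ i ≤ 3) in between
    -- are decided by comparing 8 m with i q + g, respectively 8 (m + 1) with i q.
    block : ∀ {m} → m ≤ g + 2 →
            ∑[ r < q ] ⟦ H <? residue r m ⟧ ≡
            g + (∑[ i < 4 ] ⟦ ¬? (8 * m <? i * q + g) ⟧ + ∑[ i < 3 ] ⟦ 8 * suc m <? suc i * q ⟧)
    block {m} m≤g+2 = begin
      sumTo q f                          ≡⟨ cong (λ n → sumTo n f) q≡ ⟩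
      sumTo (g + (4 + (g + 3))) f        ≡⟨ segments ⟩
      S₁ + (S₂ + (S₃ + S₄))              ≡⟨ cong₂ _+_ starts (cong₂ _+_ lowers (cong₂ _+_ middles uppers)) ⟩
      0 + (L + (g + U))                  ≡⟨ regroup L g U ⟩
      g + (L + U)                        ∎
      where
      open ≡-Reasoning
      f ℓ υ : ℕ → ℕ
      f r = ⟦ H <? residue r m ⟧
      ℓ i = ⟦ ¬? (8 * m <? i * q + g) ⟧
      υ i = ⟦ 8 * suc m <? i * q ⟧
      L U S₁ S₂ S₃ S₄ : ℕ
      L  = ∑[ i < 4 ] ℓ i
      U  = ∑[ i < 3 ] υ (suc i)
      S₁ = sumTo g f
      S₂ = ∑[ j < 4 ] f (g + j)
      S₃ = ∑[ j < g ] f (g + (4 + j))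
      S₄ = ∑[ j < 3 ] f (g + (4 + (g + j)))
      q≡ : 2 * g + 7 ≡ g + (4 + (g + 3))
      q≡ = solve (g ∷ [])
      segments : sumTo (g + (4 + (g + 3))) f ≡ S₁ + (S₂ + (S₃ + S₄))
      segments = trans (sum-++ g (4 + (g + 3)) f)
                   (cong (S₁ ℕ.+_) (trans (sum-++ 4 (g + 3) (λ j → f (g + j)))
                                        (cong (S₂ ℕ.+_) (sum-++ g 3 (λ j → f (g + (4 + j)))))))
      starts : S₁ ≡ 0
      starts = count-none g (λ r → H <? residue r m)
                          (λ r r<g → block-start r<g (≤-trans m≤g+2 (+-monoʳ-≤ g (n≤1+n 2))))
      lower-at : ∀ j i → j + i ≡ 3 → f (g + j) ≡ ℓ i
      lower-at j i j+i≡3 =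
        ⟦⟧-cong (block-lower-cut j i j+i≡3 m≤g+2) (H <? residue (g + j) m) (¬? (8 * m <? i * q + g))
      reverse : ∀ a b c d → d + (c + (b + (a + 0))) ≡ a + (b + (c + (d + 0)))
      reverse = solve-∀
      lowers : S₂ ≡ L
      lowers = trans (cong₂ _+_ (lower-at 0 3 refl) (cong₂ _+_ (lower-at 1 2 refl)
                       (cong₂ _+_ (lower-at 2 1 refl) (cong (_+ 0) (lower-at 3 0 refl)))))
                     (reverse (ℓ 0) (ℓ 1) (ℓ 2) (ℓ 3))
      middles : S₃ ≡ g
      middles = count-all g (λ j → H <? residue (g + (4 + j)) m) (λ j j<g → block-middle j j<g m≤g+2)
      upper-at : ∀ j i → j + i ≡ 3 → 0 < i → f (g + (4 + (g + j))) ≡ υ i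
      upper-at j i j+i≡3 0<i =
        ⟦⟧-cong (block-upper-cut j i j+i≡3 0<i m≤g+2) (H <? residue (g + (4 + (g + j))) m) (8 * suc m <? i * q)
      reverse₃ : ∀ a b c → c + (b + (a + 0)) ≡ a + (b + (c + 0))
      reverse₃ = solve-∀
      uppers : S₄ ≡ U
      uppers = trans (cong₂ _+_ (upper-at 0 3 refl (s≤s z≤n)) (cong₂ _+_ (upper-at 1 2 refl (s≤s z≤n))
                       (cong (_+ 0) (upper-at 2 1 refl (s≤s z≤n)))))
                     (reverse₃ (υ 1) (υ 2) (υ 3))
      regroup : ∀ L g U → 0 + (L + (g + U)) ≡ g + (L + U)
      regroup = solve-∀

    lower-count upper-count : ℕ → ℕ
    lower-count i = count (g + 3) (λ m → ¬? (8 * m <? i * q + g))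
    upper-count i = count (g + 3) (λ m → 8 * suc m <? suc i * q)

    μ-by-blocks : μ ≡ (g + 3) * g + (∑[ i < 4 ] lower-count i + ∑[ i < 3 ] upper-count i)
    μ-by-blocks = begin
      sumTo (suc H) P                                         ≡⟨ cong (λ n → sumTo n P) H+1≡ ⟩
      sumTo ((g + 3) * q + g) P                               ≡⟨ sum-++ ((g + 3) * q) g P ⟩
      sumTo ((g + 3) * q) P + ∑[ r < g ] P ((g + 3) * q + r)  ≡⟨ cong₂ _+_ (sum-blocks (g + 3) q P) last-block ⟩
      ∑[ m < g + 3 ] ∑[ r < q ] P (m * q + r) + 0             ≡⟨ +-identityʳ _ ⟩
      ∑[ m < g + 3 ] ∑[ r < q ] P (m * q + r)                 ≡⟨ sum-cong (g + 3) blocks ⟩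
      ∑[ m < g + 3 ] (g + (Λ m + Υ m))                        ≡⟨ sum-distrib-+ (g + 3) (λ _ → g) _ ⟩
      ∑[ m < g + 3 ] g + ∑[ m < g + 3 ] (Λ m + Υ m)           ≡⟨ cong₂ _+_ (sum-const (g + 3) g)
                                                                           (sum-distrib-+ (g + 3) Λ Υ) ⟩
      (g + 3) * g + (∑[ m < g + 3 ] Λ m + ∑[ m < g + 3 ] Υ m) ≡⟨ cong ((g + 3) * g ℕ.+_) (cong₂ _+_ swap₄ swap₃) ⟩
      (g + 3) * g + (∑[ i < 4 ] lower-count i + ∑[ i < 3 ] upper-count i) ∎
      where
      open ≡-Reasoning
      P : ℕ → ℕ
      P k = ⟦ H <? k * q % p ⟧
      ℓ υ : ℕ → ℕ → ℕ
      ℓ i m = ⟦ ¬? (8 * m <? i * q + g) ⟧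
      υ i m = ⟦ 8 * suc m <? suc i * q ⟧
      Λ Υ : ℕ → ℕ
      Λ m = ∑[ i < 4 ] ℓ i m
      Υ m = ∑[ i < 3 ] υ i m
      H+1≡ : suc (2 * (g * g + 7 * g + 10)) ≡ (g + 3) * (2 * g + 7) + g
      H+1≡ = solve (g ∷ [])
      blocks : ∀ m → m < g + 3 → ∑[ r < q ] P (m * q + r) ≡ g + (Λ m + Υ m)
      blocks m m<g+3 = trans (sum-cong q (λ r _ → cong (λ z → ⟦ H <? z ⟧) (residue-of-multiple m r)))
                             (block (s≤s⁻¹ (subst (m <_) (+-suc g 2) m<g+3)))
      swap₄ = sum-comm (g + 3) 4 (λ m i → ℓ i m)
      swap₃ = sum-comm (g + 3) 3 (λ m i → υ i m)
      last-block : ∑[ r < g ] P ((g + 3) * q + r) ≡ 0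
      last-block = trans (sum-cong g (λ r _ → cong (λ z → ⟦ H <? z ⟧) (residue-of-multiple (g + 3) r)))
                         (count-none g (λ r → H <? residue r (g + 3)) (λ r r<g → block-start r<g ≤-refl))

    lower-count+⌈⌉ : ∀ i → i < 4 → lower-count i + ⌈ i * q + g /8⌉ ≡ g + 3
    lower-count+⌈⌉ i i<4 = trans (cong (lower-count i ℕ.+_) (sym (count-8*< (g + 3) (i * q + g) bound)))
                                 (count-¬ (g + 3) (λ m → 8 * m <? i * q + g))
      where
      slack : 3 * (2 * g + 7) + g + (g + 3) ≡ 8 * (g + 3)
      slack = solve (g ∷ [])
      bound : i * q + g ≤ 8 * (g + 3)
      bound = ≤-trans (+-monoˡ-≤ g (*-monoˡ-≤ q (s≤s⁻¹ i<4))) (m+n≤o⇒m≤o _ (≤-reflexive slack))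

    upper-count+1 : ∀ i → i < 3 → upper-count i + 1 ≡ ⌈ suc i * q /8⌉
    upper-count+1 i i<3 = begin
      upper-count i + 1                                 ≡⟨ +-comm (upper-count i) 1 ⟩
      1 + upper-count i                                 ≡⟨ cong (_+ upper-count i) (sym (⟦⟧-yes (0 <? _) 0<iq)) ⟩
      count (suc (g + 3)) (λ m → 8 * m <? suc i * q)    ≡⟨ count-8*< (suc (g + 3)) (suc i * q) bound ⟩
      ⌈ suc i * q /8⌉                                   ∎
      where
      open ≡-Reasoning
      slack : 3 * (2 * g + 7) + (2 * g + 11) ≡ 8 * suc (g + 3)
      slack = solve (g ∷ [])
      0<iq : 0 < suc i * q
      0<iq = ≤-trans (≤-trans (s≤s z≤n) (m≤n+m 7 (2 * g))) (m≤m+n q (i * q))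
      bound : suc i * q ≤ 8 * suc (g + 3)
      bound = ≤-trans (*-monoˡ-≤ q i<3) (m+n≤o⇒m≤o _ (≤-reflexive slack))

    μ-closed-form : μ + (∑[ i < 4 ] ⌈ i * q + g /8⌉ + 3) ≡ (g + 3) * (g + 4) + ∑[ i < 3 ] ⌈ suc i * q /8⌉
    μ-closed-form = begin
      μ + (C + 3)                                    ≡⟨ cong (_+ (C + 3)) μ-by-blocks ⟩
      (g + 3) * g + (A + B) + (C + 3)                ≡⟨ regroup ((g + 3) * g) A B C ⟩
      (g + 3) * g + (A + C) + (B + 3)                ≡⟨ cong₂ (λ x y → (g + 3) * g + x + y) A+C≡ B+3≡ ⟩
      (g + 3) * g + 4 * (g + 3) + D                  ≡⟨ cong (_+ D) (factor g) ⟩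
      (g + 3) * (g + 4) + D                          ∎
      where
      open ≡-Reasoning
      A B C D : ℕ
      A = ∑[ i < 4 ] lower-count i
      B = ∑[ i < 3 ] upper-count i
      C = ∑[ i < 4 ] ⌈ i * q + g /8⌉
      D = ∑[ i < 3 ] ⌈ suc i * q /8⌉
      A+C≡ : A + C ≡ 4 * (g + 3)
      A+C≡ = trans (sym (sum-distrib-+ 4 lower-count (λ i → ⌈ i * q + g /8⌉)))
                   (trans (sum-cong 4 lower-count+⌈⌉) (sum-const 4 (g + 3)))
      B+3≡ : B + 3 ≡ D
      B+3≡ = trans (cong (B ℕ.+_) (sym (sum-const 3 1)))
                   (trans (sym (sum-distrib-+ 3 upper-count (λ _ → 1))) (sum-cong 3 upper-count+1))
      regroup : ∀ x A B C → x + (A + B) + (C + 3) ≡ x + (A + C) + (B + 3)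
      regroup = solve-∀
      factor : ∀ g → (g + 3) * g + 4 * (g + 3) ≡ (g + 3) * (g + 4)
      factor = solve-∀

  μ-mod-8 : ∀ y c → let open GaussCount (8 * y + c) in
            μ + (16 * y + (∑[ i < 4 ] ⌈ i * (2 * c + 7) + c /8⌉ + 3))
              ≡ (8 * y + c + 3) * (8 * y + c + 4) + (12 * y + ∑[ i < 3 ] ⌈ suc i * (2 * c + 7) /8⌉)
  μ-mod-8 y c = begin
    μ + (16 * y + (∑[ i < 4 ] k i + 3))                         ≡⟨ cong (μ ℕ.+_) (sym (+-assoc (16 * y) _ 3)) ⟩
    μ + (16 * y + ∑[ i < 4 ] k i + 3)                           ≡⟨ cong (λ z → μ + (z + 3)) (sym lowers) ⟩
    μ + (∑[ i < 4 ] ⌈ i * q + g /8⌉ + 3)                         ≡⟨ μ-closed-form ⟩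
    (g + 3) * (g + 4) + ∑[ i < 3 ] ⌈ suc i * q /8⌉               ≡⟨ cong (λ z → (g + 3) * (g + 4) + z) uppers ⟩
    (g + 3) * (g + 4) + (12 * y + ∑[ i < 3 ] l i)               ∎
    where
    open ≡-Reasoning
    open GaussCount (8 * y + c)
    g = 8 * y + c
    k l : ℕ → ℕ
    k i = ⌈ i * (2 * c + 7) + c /8⌉
    l i = ⌈ suc i * (2 * c + 7) /8⌉
    lowers : ∑[ i < 4 ] ⌈ i * q + g /8⌉ ≡ 16 * y + ∑[ i < 4 ] k i
    lowers = trans (sum-cong 4 (λ i _ → trans (cong ⌈_/8⌉ (regroup i)) (⌈*8+/8⌉ ((2 * i + 1) * y) _)))
                   (trans (sum-distrib-+ 4 (λ i → (2 * i + 1) * y) k) (cong (_+ ∑[ i < 4 ] k i) sixteen))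
      where
      regroup : ∀ i → i * (2 * (8 * y + c) + 7) + (8 * y + c) ≡ (2 * i + 1) * y * 8 + (i * (2 * c + 7) + c)
      regroup i = solve (i ∷ y ∷ c ∷ [])
      sixteen : 1 * y + (3 * y + (5 * y + (7 * y + 0))) ≡ 16 * y
      sixteen = solve (y ∷ [])
    uppers : ∑[ i < 3 ] ⌈ suc i * q /8⌉ ≡ 12 * y + ∑[ i < 3 ] l i
    uppers = trans (sum-cong 3 (λ i _ → trans (cong ⌈_/8⌉ (regroup i)) (⌈*8+/8⌉ (2 * suc i * y) _)))
                   (trans (sum-distrib-+ 3 (λ i → 2 * suc i * y) l) (cong (_+ ∑[ i < 3 ] l i) twelve))
      where
      regroup : ∀ i → suc i * (2 * (8 * y + c) + 7) ≡ 2 * suc i * y * 8 + suc i * (2 * c + 7)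
      regroup i = solve (i ∷ y ∷ c ∷ [])
      twelve : 2 * y + (4 * y + (6 * y + 0)) ≡ 12 * y
      twelve = solve (y ∷ [])

  μ-even-8y+2 : ∀ y → ∃[ Z ] GaussCount.μ (8 * y + 2) ≡ 2 * Z
  μ-even-8y+2 y = 32 * (y * y) + 42 * y + 13 , +-cancelʳ-≡ (16 * y + 14) _ _ (trans (μ-mod-8 y 2) arithmetic)
    where
    arithmetic : (8 * y + 2 + 3) * (8 * y + 2 + 4) + (12 * y + 10) ≡ 2 * (32 * (y * y) + 42 * y + 13) + (16 * y + 14)
    arithmetic = solve (y ∷ [])

  μ-even-8y+6 : ∀ y → ∃[ Z ] GaussCount.μ (8 * y + 6) ≡ 2 * Z
  μ-even-8y+6 y = 32 * (y * y) + 74 * y + 42 , +-cancelʳ-≡ (16 * y + 22) _ _ (trans (μ-mod-8 y 6) arithmetic)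
    where
    arithmetic : (8 * y + 6 + 3) * (8 * y + 6 + 4) + (12 * y + 16) ≡ 2 * (32 * (y * y) + 74 * y + 42) + (16 * y + 22)
    arithmetic = solve (y ∷ [])

  μ-odd-8y+7 : ∀ y → ∃[ Z ] GaussCount.μ (8 * y + 7) ≡ 1 + 2 * Z
  μ-odd-8y+7 y = 32 * (y * y) + 82 * y + 51 , +-cancelʳ-≡ (16 * y + 24) _ _ (trans (μ-mod-8 y 7) arithmetic)
    where
    arithmetic : (8 * y + 7 + 3) * (8 * y + 7 + 4) + (12 * y + 17) ≡ 1 + 2 * (32 * (y * y) + 82 * y + 51) + (16 * y + 24)
    arithmetic = solve (y ∷ [])

open Counting

-- The quartic character of 2 modulo p = 4u² + 12u + 1

module QuarticCharacterOfTwo where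

  open import Data.Nat.Base using (_+_; _*_)
  open import Data.Nat.Tactic.RingSolver using (solve-∀; solve)

  TwoInCoset : ℕ → ℕ → Set
  TwoInCoset P i = ∀ α → Primitive P α → InCoset4 P α i 2

  module _ (g : ℕ) (p-prime : Prime (GaussCount.p g)) where

    open GaussCount g
    open Congruence p
    open QuarticCosets p Q refl p-prime using (2^Q≈-1^μ; coset-by-power; α^2Q≈-1; 2<p)

    2^Q≈-1^μ-q : (+ 2) ℤ.^ Q ≈ -1ℤ ℤ.^ μ
    2^Q≈-1^μ-q = 2^Q≈-1^μ q q²≈8 (∤-small 0<q q<p)
      where
      0<q : 0 ℕ.< q
      0<q = ℕP.≤-trans (s≤s z≤n) (ℕP.m≤n+m 7 (2 * g))
      gap : suc (2 * g + 7) + (4 * (g * g) + 26 * g + 33) ≡ suc (4 * (g * g + 7 * g + 10))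
      gap = solve (g ∷ [])
      q<p : q ℕ.< p
      q<p = ℕP.m+n≤o⇒m≤o _ (ℕP.≤-reflexive gap)
      q²≡8+p : (2 * g + 7) * ((2 * g + 7) * 1) ≡ 8 + 1 * suc (4 * (g * g + 7 * g + 10))
      q²≡8+p = solve (g ∷ [])
      +8+p≡ : + (8 + 1 * p) ≡ + 8 ℤ.+ + 1 ℤ.* + p
      +8+p≡ = trans (ℤP.pos-+ 8 (1 * p)) (cong (λ z → + 8 ℤ.+ z) (ℤP.pos-* 1 p))
      q²≈8 : (+ q) ℤ.^ 2 ≈ + 8
      q²≈8 = subst (_≈ + 8) (trans (cong +_ (sym q²≡8+p)) (pos-^ q 2))
               (subst (_≈ + 8) (sym +8+p≡) (+-multiple (+ 8) (+ 1)))

    2∈C₀ : ∃[ Z ] μ ≡ 2 * Z → TwoInCoset p 0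
    2∈C₀ (Z , μ≡2Z) α α-primitive = coset-by-power α α-primitive 0 (s≤s z≤n) 2<p (s≤s z≤n)
      (≈-trans 2^Q≈-1^μ-q (≈-reflexive (trans (cong (-1ℤ ℤ.^_) μ≡2Z) (-1^[2*m]≡1 Z))))

    2∈C₂ : ∃[ Z ] μ ≡ 1 + 2 * Z → TwoInCoset p 2
    2∈C₂ (Z , μ≡1+2Z) α α-primitive = coset-by-power α α-primitive 2 (s≤s z≤n) 2<p (s≤s (s≤s (s≤s z≤n)))
      (≈-trans 2^Q≈-1^μ-q (≈-trans (≈-reflexive -1^μ≡-1) (≈-sym (α^2Q≈-1 α α-primitive))))
      where
      -1^μ≡-1 : -1ℤ ℤ.^ μ ≡ -1ℤ
      -1^μ≡-1 = trans (cong (-1ℤ ℤ.^_) μ≡1+2Z) (cong (-1ℤ ℤ.*_) (-1^[2*m]≡1 Z))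

  -- u = 1 corresponds to g = −1, outside the range of GaussCount; there p = 17 and 2⁴ = 16 ≡ −1.
  2∈C₂-mod-17 : Prime 17 → TwoInCoset 17 2
  2∈C₂-mod-17 p-prime α α-primitive = coset-by-power α α-primitive 2 (s≤s z≤n) 2<p (s≤s (s≤s (s≤s z≤n)))
                                        (≈-trans 16≈-1 (≈-sym (α^2Q≈-1 α α-primitive)))
    where
    open QuarticCosets 17 4 refl p-prime
    open Congruence 17
    16≈-1 : (+ 2) ℤ.^ 4 ≈ -1ℤ
    16≈-1 = mk≈ (divides (+ 1) refl)

  TwoInCoset-pOf : ∀ {u} g i → u ≡ g + 2 → (Prime (GaussCount.p g) → TwoInCoset (GaussCount.p g) i) →
                   Prime (pOf u) → TwoInCoset (pOf u) i
  TwoInCoset-pOf g i refl 2∈Cᵢ p-prime = subst (λ P → TwoInCoset P i) (sym pOf≡p) (2∈Cᵢ (subst Prime pOf≡p p-prime))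
    where
    pOf≡p : 4 * ((g + 2) * (g + 2)) + 12 * (g + 2) + 1 ≡ suc (4 * (g * g + 7 * g + 10))
    pOf≡p = solve (g ∷ [])

  mod-4 : ∀ s → ∃[ t ] (s ≡ t * 4 ⊎ s ≡ 1 + t * 4 ⊎ s ≡ 2 + t * 4 ⊎ s ≡ 3 + t * 4)
  mod-4 s with s % 4 | m%n<n s 4 | m≡m%n+[m/n]*n s 4
  ... | 0 | _ | s≡ = s / 4 , inj₁ s≡
  ... | 1 | _ | s≡ = s / 4 , inj₂ (inj₁ s≡)
  ... | 2 | _ | s≡ = s / 4 , inj₂ (inj₂ (inj₁ s≡))
  ... | 3 | _ | s≡ = s / 4 , inj₂ (inj₂ (inj₂ s≡))
  ... | suc (suc (suc (suc _))) | s≤s (s≤s (s≤s (s≤s ()))) | _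

  private
    square₀ : ∀ t → suc t * 4 * (suc t * 4) ≡ 8 * (2 * (t * t) + 4 * t + 1) + 6 + 2
    square₀ = solve-∀
    square₁ : ∀ t → (1 + suc t * 4) * (1 + suc t * 4) ≡ 8 * (2 * (t * t) + 5 * t + 2) + 7 + 2
    square₁ = solve-∀
    square₂ : ∀ t → (2 + t * 4) * (2 + t * 4) ≡ 8 * (2 * (t * t) + 2 * t) + 2 + 2
    square₂ = solve-∀
    square₃ : ∀ t → (3 + t * 4) * (3 + t * 4) ≡ 8 * (2 * (t * t) + 3 * t) + 7 + 2
    square₃ = solve-∀

  square-mod-8 : ∀ s → NonZero s →
                 s ≡ 1 ⊎ ∃[ y ] (s * s ≡ 8 * y + 2 + 2 ⊎ s * s ≡ 8 * y + 6 + 2 ⊎ s * s ≡ 8 * y + 7 + 2)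
  square-mod-8 s s≢0 with mod-4 s
  ... | zero  , inj₁ refl             = ⊥-elim (ℕ.≢-nonZero⁻¹ 0 {{s≢0}} refl)
  ... | suc t , inj₁ refl             = inj₂ (2 * (t * t) + 4 * t + 1 , inj₂ (inj₁ (square₀ t)))
  ... | zero  , inj₂ (inj₁ refl)      = inj₁ refl
  ... | suc t , inj₂ (inj₁ refl)      = inj₂ (2 * (t * t) + 5 * t + 2 , inj₂ (inj₂ (square₁ t)))
  ... | t , inj₂ (inj₂ (inj₁ refl))   = inj₂ (2 * (t * t) + 2 * t , inj₁ (square₂ t))
  ... | t , inj₂ (inj₂ (inj₂ refl))   = inj₂ (2 * (t * t) + 3 * t , inj₂ (inj₂ (square₃ t)))

  private
    %2-of : ∀ {n} b k → n ≡ b + k * 2 → n % 2 ≡ b % 2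
    %2-of b k n≡ = trans (cong (_% 2) n≡) ([m+kn]%n≡m%n b k 2)
    class-2 : ∀ y → 8 * y + 2 + 2 ≡ 0 + (4 * y + 2) * 2
    class-2 = solve-∀
    class-6 : ∀ y → 8 * y + 6 + 2 ≡ 0 + (4 * y + 4) * 2
    class-6 = solve-∀
    class-7 : ∀ y → 8 * y + 7 + 2 ≡ 1 + (4 * y + 4) * 2
    class-7 = solve-∀
    0≢1 : 0 ≢ 1
    0≢1 ()

  even-square-mod-8 : ∀ s → NonZero s → s * s % 2 ≡ 0 →
                      ∃[ y ] (s * s ≡ 8 * y + 2 + 2 ⊎ s * s ≡ 8 * y + 6 + 2)
  even-square-mod-8 s s≢0 even with square-mod-8 s s≢0
  ... | inj₁ refl                  = ⊥-elim (0≢1 (sym even))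
  ... | inj₂ (y , inj₁ s²≡)        = y , inj₁ s²≡
  ... | inj₂ (y , inj₂ (inj₁ s²≡)) = y , inj₂ s²≡
  ... | inj₂ (y , inj₂ (inj₂ s²≡)) = ⊥-elim (0≢1 (trans (sym even) (%2-of 1 (4 * y + 4) (trans s²≡ (class-7 y)))))

  odd-square-mod-8 : ∀ s → NonZero s → s * s % 2 ≡ 1 → s ≡ 1 ⊎ ∃[ y ] s * s ≡ 8 * y + 7 + 2
  odd-square-mod-8 s s≢0 odd with square-mod-8 s s≢0
  ... | inj₁ s≡1                   = inj₁ s≡1
  ... | inj₂ (y , inj₁ s²≡)        = ⊥-elim (0≢1 (trans (sym (%2-of 0 (4 * y + 2) (trans s²≡ (class-2 y)))) odd))
  ... | inj₂ (y , inj₂ (inj₁ s²≡)) = ⊥-elim (0≢1 (trans (sym (%2-of 0 (4 * y + 4) (trans s²≡ (class-6 y)))) odd))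
  ... | inj₂ (y , inj₂ (inj₂ s²≡)) = inj₂ (y , s²≡)

  quartic-character-of-2 : ∀ s → NonZero s → Prime (pOf (s * s)) →
                           (s * s % 2 ≡ 0 → TwoInCoset (pOf (s * s)) 0) ×
                           (s * s % 2 ≡ 1 → TwoInCoset (pOf (s * s)) 2)
  quartic-character-of-2 s s≢0 p-prime = even , odd
    where
    even : s * s % 2 ≡ 0 → TwoInCoset (pOf (s * s)) 0
    even u-even with even-square-mod-8 s s≢0 u-even
    ... | y , inj₁ u≡ = TwoInCoset-pOf (8 * y + 2) 0 u≡ (λ pr → 2∈C₀ (8 * y + 2) pr (μ-even-8y+2 y)) p-prime
    ... | y , inj₂ u≡ = TwoInCoset-pOf (8 * y + 6) 0 u≡ (λ pr → 2∈C₀ (8 * y + 6) pr (μ-even-8y+6 y)) p-prime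
    odd : s * s % 2 ≡ 1 → TwoInCoset (pOf (s * s)) 2
    odd u-odd with odd-square-mod-8 s s≢0 u-odd
    ... | inj₁ refl     = 2∈C₂-mod-17 p-prime
    ... | inj₂ (y , u≡) = TwoInCoset-pOf (8 * y + 7) 2 u≡ (λ pr → 2∈C₂ (8 * y + 7) pr (μ-odd-8y+7 y)) p-prime

open QuarticCharacterOfTwo

-- Representations p = x² + n y²

module Representations where

  open import Data.Integer using (_+_; _-_; _*_; -_)
  open import Data.Integer.Tactic.RingSolver using (solve-∀)

  open Congruence using (euclid)


  square-abs : ∀ y → y * y ≡ + (ℤ.∣ y ∣ ℕ.* ℤ.∣ y ∣)
  square-abs (+ n)    = sym (ℤP.pos-* n n)
  square-abs ℤ.-[1+ n ] = refl

  *-self-injective : ∀ a c → a * a ≡ c * c → a ≡ c ⊎ a ≡ - c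
  *-self-injective a c a²≡c² with ℤP.i*j≡0⇒i≡0∨j≡0 (a - c) difference
    where
    factor : ∀ a c → (a - c) * (a + c) ≡ a * a - c * c
    factor = solve-∀
    difference : (a - c) * (a + c) ≡ 0ℤ
    difference = trans (factor a c) (trans (cong (_- c * c) a²≡c²) (ℤP.+-inverseʳ (c * c)))
  ... | inj₁ a-c≡0 = inj₁ (ℤP.i-j≡0⇒i≡j a c a-c≡0)
  ... | inj₂ a+c≡0 = inj₂ (ℤP.i-j≡0⇒i≡j a (- c) (trans (cong (λ z → a + z) (ℤP.neg-involutive c)) a+c≡0))

  module _ {p n : ℕ} (0<p : 0 ℕ.< p) (2≤n : 2 ℕ.≤ n) where

    multiple-vanishes : ∀ {x y} → + p ∣ x → y * y + + n * (x * x) ≡ + p * + p → x ≡ 0ℤ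
    multiple-vanishes {x} {y} (divides k x≡kp) sum≡p² = by-cases ℤ.∣ k ∣ refl
      where
      |x| = ℤ.∣ x ∣
      |y| = ℤ.∣ y ∣
      sumℕ≡p² : |y| ℕ.* |y| ℕ.+ n ℕ.* (|x| ℕ.* |x|) ≡ p ℕ.* p
      sumℕ≡p² = ℤP.+-injective (begin
        + (|y| ℕ.* |y| ℕ.+ n ℕ.* (|x| ℕ.* |x|))     ≡⟨ ℤP.pos-+ (|y| ℕ.* |y|) (n ℕ.* (|x| ℕ.* |x|)) ⟩
        + (|y| ℕ.* |y|) + + (n ℕ.* (|x| ℕ.* |x|))   ≡⟨ cong₂ _+_ (sym (square-abs y)) n|x|²≡ ⟩
        y * y + + n * (x * x)                       ≡⟨ sum≡p² ⟩
        + p * + p                                   ≡⟨ ℤP.pos-* p p ⟨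
        + (p ℕ.* p)                                 ∎)
        where
        open ≡-Reasoning
        n|x|²≡ : + (n ℕ.* (|x| ℕ.* |x|)) ≡ + n * (x * x)
        n|x|²≡ = trans (ℤP.pos-* n _) (cong ((+ n) *_) (sym (square-abs x)))
      by-cases : ∀ m → ℤ.∣ k ∣ ≡ m → x ≡ 0ℤ
      by-cases zero    |k|≡0 = trans x≡kp (cong (_* + p) (ℤP.∣i∣≡0⇒i≡0 {k} |k|≡0))
      by-cases (suc j) |k|≡ = ⊥-elim (ℕP.<⇒≱ p²<sum (ℕP.≤-reflexive sumℕ≡p²))
        where
        p≤|x| : p ℕ.≤ |x|
        p≤|x| = subst (p ℕ.≤_) (sym |x|≡) (ℕP.m≤m+n p (j ℕ.* p))
          where
          |x|≡ : |x| ≡ suc j ℕ.* p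
          |x|≡ = trans (cong ℤ.∣_∣ x≡kp) (trans (ℤP.abs-* k (+ p)) (cong (ℕ._* p) |k|≡))
        p²<sum : p ℕ.* p ℕ.< |y| ℕ.* |y| ℕ.+ n ℕ.* (|x| ℕ.* |x|)
        p²<sum = ℕP.<-≤-trans (ℕP.m<m+n (p ℕ.* p) (ℕP.*-mono-< 0<p 0<p))
                   (ℕP.≤-trans (ℕP.≤-reflexive (cong (p ℕ.* p ℕ.+_) (sym (ℕP.+-identityʳ (p ℕ.* p)))))
                     (ℕP.≤-trans (ℕP.*-mono-≤ 2≤n (ℕP.*-mono-≤ p≤|x| p≤|x|))
                                 (ℕP.m≤n+m _ (|y| ℕ.* |y|))))

  OneMod4-¬neg : ∀ {x} → OneMod4 x → ¬ OneMod4 (- x)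
  OneMod4-¬neg {x} x≡1 -x≡1 with ℕ∣.∣⇒≤ {2} (∣⇒∣ᵤ 4∣-2)
    where
    sum : ∀ x → (x - + 1) + (- x - + 1) ≡ - + 2
    sum = solve-∀
    4∣-2 : + 4 ∣ - + 2
    4∣-2 = subst (+ 4 ∣_) (sum x) (∣m∣n⇒∣m+n {+ 4} {x - + 1} { - x - + 1} (∣ᵤ⇒∣ x≡1) (∣ᵤ⇒∣ -x≡1))
  ... | s≤s (s≤s ())

  difference-of-products : ∀ a b c d N → (a * d - b * c) * (a * d + b * c)
                                        ≡ d * d * (a * a + N * (b * b)) - b * b * (c * c + N * (d * d))
  difference-of-products = solve-∀

  brahmagupta₊ : ∀ a b c d N → (a * c + N * b * d) * (a * c + N * b * d) + N * ((a * d - b * c) * (a * d - b * c))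
                               ≡ (a * a + N * (b * b)) * (c * c + N * (d * d))
  brahmagupta₊ = solve-∀

  brahmagupta₋ : ∀ a b c d N → (a * c - N * b * d) * (a * c - N * b * d) + N * ((a * d + b * c) * (a * d + b * c))
                               ≡ (a * a + N * (b * b)) * (c * c + N * (d * d))
  brahmagupta₋ = solve-∀

  private
    factor : ∀ D B P → D * P - B * P ≡ P * (D - B)
    factor = solve-∀

    cancel : ∀ x y → x ≡ x + y - y
    cancel = solve-∀

  module _ {p n : ℕ} (p-prime : Prime p) (2≤n : 2 ℕ.≤ n) where

    private
      0<p : 0 ℕ.< p
      0<p = ℕP.n≢0⇒n>0 (ℕ.≢-nonZero⁻¹ p {{prime⇒nonZero p-prime}})

    same-squares : ∀ {a b c d} → + p ≡ a * a + + n * (b * b) → + p ≡ c * c + + n * (d * d) →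
                   a * a ≡ c * c × b * b ≡ d * d
    same-squares {a} {b} {c} {d} p≡ab p≡cd = a²≡c² , b²≡d²
      where
      open ≡-Reasoning
      P N : ℤ
      P = + p
      N = + n
      conjugates : (a * d - b * c) * (a * d + b * c) ≡ P * (d * d - b * b)
      conjugates = begin
        (a * d - b * c) * (a * d + b * c)                             ≡⟨ difference-of-products a b c d N ⟩
        d * d * (a * a + N * (b * b)) - b * b * (c * c + N * (d * d)) ≡⟨ cong₂ (λ u v → d * d * u - b * b * v)
                                                                                 (sym p≡ab) (sym p≡cd) ⟩
        d * d * P - b * b * P                                         ≡⟨ factor (d * d) (b * b) P ⟩
        P * (d * d - b * b)                                           ∎
      norm₁ : (a * c + N * b * d) * (a * c + N * b * d) + N * ((a * d - b * c) * (a * d - b * c)) ≡ P * P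
      norm₁ = trans (brahmagupta₊ a b c d N) (sym (cong₂ _*_ p≡ab p≡cd))
      norm₂ : (a * c - N * b * d) * (a * c - N * b * d) + N * ((a * d + b * c) * (a * d + b * c)) ≡ P * P
      norm₂ = trans (brahmagupta₋ a b c d N) (sym (cong₂ _*_ p≡ab p≡cd))
      conjugates-vanish : (a * d - b * c) * (a * d + b * c) ≡ 0ℤ
      conjugates-vanish = [ left-vanishes , right-vanishes ]′ (euclid p p-prime (a * d - b * c) (a * d + b * c) p∣)
        where
        p∣ : P ∣ (a * d - b * c) * (a * d + b * c)
        p∣ = subst (P ∣_) (sym conjugates) (∣m⇒∣m*n {P} {P} (d * d - b * b) (∣-refl {P}))
        left-vanishes : + p ∣ a * d - b * c → (a * d - b * c) * (a * d + b * c) ≡ 0ℤ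
        left-vanishes p∣ad-bc = subst (λ z → z * (a * d + b * c) ≡ 0ℤ)
          (sym (multiple-vanishes 0<p 2≤n {a * d - b * c} {a * c + N * b * d} p∣ad-bc norm₁))
          (ℤP.*-zeroˡ (a * d + b * c))
        right-vanishes : + p ∣ a * d + b * c → (a * d - b * c) * (a * d + b * c) ≡ 0ℤ
        right-vanishes p∣ad+bc = subst (λ z → (a * d - b * c) * z ≡ 0ℤ)
          (sym (multiple-vanishes 0<p 2≤n {a * d + b * c} {a * c - N * b * d} p∣ad+bc norm₂))
          (ℤP.*-zeroʳ (a * d - b * c))
      b²≡d² : b * b ≡ d * d
      b²≡d² = [ P≢0 , (λ d²-b²≡0 → sym (ℤP.i-j≡0⇒i≡j (d * d) (b * b) d²-b²≡0)) ]′
        (ℤP.i*j≡0⇒i≡0∨j≡0 P {d * d - b * b} (trans (sym conjugates) conjugates-vanish))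
        where
        P≢0 : P ≡ 0ℤ → b * b ≡ d * d
        P≢0 P≡0 = ⊥-elim (ℕP.<⇒≢ 0<p (sym (ℤP.+-injective P≡0)))
      a²≡c² : a * a ≡ c * c
      a²≡c² = begin
        a * a                             ≡⟨ cancel (a * a) (N * (b * b)) ⟩
        a * a + N * (b * b) - N * (b * b) ≡⟨ cong₂ (λ u v → u - N * v) (sym p≡ab) b²≡d² ⟩
        P - N * (d * d)                   ≡⟨ cong (_- N * (d * d)) p≡cd ⟩
        c * c + N * (d * d) - N * (d * d) ≡⟨ cancel (c * c) (N * (d * d)) ⟨
        c * c                             ∎

    representation-unique : ∀ {X₀ Y₀} → + p ≡ X₀ * X₀ + + n * (Y₀ * Y₀) → OneMod4 X₀ → ∀ x y →
                            (+ p ≡ x * x + + n * (y * y) × OneMod4 x) ⇔ (x ≡ X₀ × (y ≡ Y₀ ⊎ y ≡ - Y₀))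
    representation-unique {X₀} {Y₀} p≡X₀Y₀ X₀≡1 x y = mk⇔ to from
      where
      to : + p ≡ x * x + + n * (y * y) × OneMod4 x → x ≡ X₀ × (y ≡ Y₀ ⊎ y ≡ - Y₀)
      to (p≡xy , x≡1) = x≡X₀ (*-self-injective x X₀ (proj₁ squares)) , *-self-injective y Y₀ (proj₂ squares)
        where
        squares = same-squares {x} {y} {X₀} {Y₀} p≡xy p≡X₀Y₀
        x≡X₀ : x ≡ X₀ ⊎ x ≡ - X₀ → x ≡ X₀
        x≡X₀ (inj₁ x≡X₀)  = x≡X₀
        x≡X₀ (inj₂ x≡-X₀) = ⊥-elim (OneMod4-¬neg {X₀} X₀≡1 (subst OneMod4 x≡-X₀ x≡1))
      from : x ≡ X₀ × (y ≡ Y₀ ⊎ y ≡ - Y₀) → + p ≡ x * x + + n * (y * y) × OneMod4 x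
      from (refl , inj₁ refl) = p≡X₀Y₀ , X₀≡1
      from (refl , inj₂ refl) = trans p≡X₀Y₀ (cong (λ z → X₀ * X₀ + + n * z) (neg-square Y₀)) , X₀≡1
        where
        neg-square : ∀ y → y * y ≡ - y * - y
        neg-square = solve-∀

open Representations

module _ (u : ℕ) where

  open import Data.Integer using (_+_; _-_; _*_; -_)
  open import Data.Integer.Tactic.RingSolver using (solve-∀)

  private
    OneMod4-by : ∀ x k → x - + 1 ≡ k * + 4 → OneMod4 x
    OneMod4-by x k eq = ∣⇒∣ᵤ (divides k eq)

    +u≡ : ∀ b → u % 2 ≡ b → + u ≡ + b + + (u / 2) * + 2
    +u≡ b u%2≡b = trans (cong +_ (trans (m≡m%n+[m/n]*n u 2) (cong (ℕ._+ (u / 2) ℕ.* 2) u%2≡b)))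
                        (trans (ℤP.pos-+ b ((u / 2) ℕ.* 2)) (cong (λ z → + b + z) (ℤP.pos-* (u / 2) 2)))

  OneMod4-even : u % 2 ≡ 0 → OneMod4 (- (+ 2) * (+ u) + (+ 1)) × OneMod4 ((+ 2) * (+ u) + (+ 1))
  OneMod4-even u-even = by-halves (+ u) (+ (u / 2)) (+u≡ 0 u-even)
    where
    minus : ∀ K → - (+ 2) * (+ 0 + K * + 2) + + 1 - + 1 ≡ - K * + 4
    minus = solve-∀
    plus : ∀ K → + 2 * (+ 0 + K * + 2) + + 1 - + 1 ≡ K * + 4
    plus = solve-∀
    by-halves : ∀ U K → U ≡ + 0 + K * + 2 → OneMod4 (- (+ 2) * U + (+ 1)) × OneMod4 ((+ 2) * U + (+ 1))
    by-halves _ K refl = OneMod4-by (- (+ 2) * (+ 0 + K * + 2) + (+ 1)) (- K) (minus K)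
                       , OneMod4-by ((+ 2) * (+ 0 + K * + 2) + (+ 1)) K (plus K)

  OneMod4-odd : u % 2 ≡ 1 → OneMod4 ((+ 2) * (+ u) - (+ 1)) × OneMod4 (- (+ 2) * (+ u) - (+ 1))
  OneMod4-odd u-odd = by-halves (+ u) (+ (u / 2)) (+u≡ 1 u-odd)
    where
    plus : ∀ K → + 2 * (+ 1 + K * + 2) - + 1 - + 1 ≡ K * + 4
    plus = solve-∀
    minus : ∀ K → - (+ 2) * (+ 1 + K * + 2) - + 1 - + 1 ≡ - (K + + 1) * + 4
    minus = solve-∀
    by-halves : ∀ U K → U ≡ + 1 + K * + 2 → OneMod4 ((+ 2) * U - (+ 1)) × OneMod4 (- (+ 2) * U - (+ 1))
    by-halves _ K refl = OneMod4-by ((+ 2) * (+ 1 + K * + 2) - (+ 1)) K (plus K)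
                       , OneMod4-by (- (+ 2) * (+ 1 + K * + 2) - (+ 1)) (- (K + + 1)) (minus K)

module _ (s : ℕ) where

  open import Data.Integer using (_+_; _-_; _*_; -_)
  open import Data.Integer.Tactic.RingSolver using (solve-∀)

  private
    U Y P : ℤ
    U = + (s ℕ.* s)
    Y = (+ 2) * (+ s)
    P = + pOf (s ℕ.* s)

    pOfℤ : ℤ → ℤ
    pOfℤ V = + 4 * (V * V) + + 12 * V + + 1

    P≡ : P ≡ pOfℤ U
    P≡ = trans (ℤP.pos-+ (4 ℕ.* (u ℕ.* u) ℕ.+ 12 ℕ.* u) 1)
           (cong (_+ + 1) (trans (ℤP.pos-+ (4 ℕ.* (u ℕ.* u)) (12 ℕ.* u))
                                 (cong₂ _+_ (trans (ℤP.pos-* 4 (u ℕ.* u)) (cong ((+ 4) *_) (ℤP.pos-* u u)))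
                                            (ℤP.pos-* 12 u))))
      where
      u = s ℕ.* s

    from-identity : (X : ℤ → ℤ) (n : ℤ) → (∀ S → pOfℤ (S * S) ≡ X (S * S) * X (S * S) + n * ((+ 2 * S) * (+ 2 * S))) →
                    P ≡ X U * X U + n * (Y * Y)
    from-identity X n identity =
      trans P≡ (subst (λ V → pOfℤ V ≡ X V * X V + n * (Y * Y)) (sym (ℤP.pos-* s s)) (identity (+ s)))

    identity₁ : ∀ S → + 4 * ((S * S) * (S * S)) + + 12 * (S * S) + + 1
                    ≡ (- (+ 2) * (S * S) + (+ 1)) * (- (+ 2) * (S * S) + (+ 1)) + (+ 4) * ((+ 2 * S) * (+ 2 * S))
    identity₁ = solve-∀
    identity₂ : ∀ S → + 4 * ((S * S) * (S * S)) + + 12 * (S * S) + + 1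
                    ≡ ((+ 2) * (S * S) - (+ 1)) * ((+ 2) * (S * S) - (+ 1)) + (+ 4) * ((+ 2 * S) * (+ 2 * S))
    identity₂ = solve-∀
    identity₃ : ∀ S → + 4 * ((S * S) * (S * S)) + + 12 * (S * S) + + 1
                    ≡ ((+ 2) * (S * S) + (+ 1)) * ((+ 2) * (S * S) + (+ 1)) + (+ 2) * ((+ 2 * S) * (+ 2 * S))
    identity₃ = solve-∀
    identity₄ : ∀ S → + 4 * ((S * S) * (S * S)) + + 12 * (S * S) + + 1
                    ≡ (- (+ 2) * (S * S) - (+ 1)) * (- (+ 2) * (S * S) - (+ 1)) + (+ 2) * ((+ 2 * S) * (+ 2 * S))
    identity₄ = solve-∀

  p≡[1-2u]²+4y² : P ≡ (- (+ 2) * U + (+ 1)) * (- (+ 2) * U + (+ 1)) + (+ 4) * (Y * Y)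
  p≡[1-2u]²+4y² = from-identity (λ V → - (+ 2) * V + (+ 1)) (+ 4) identity₁

  p≡[2u-1]²+4y² : P ≡ ((+ 2) * U - (+ 1)) * ((+ 2) * U - (+ 1)) + (+ 4) * (Y * Y)
  p≡[2u-1]²+4y² = from-identity (λ V → (+ 2) * V - (+ 1)) (+ 4) identity₂

  p≡[2u+1]²+2y² : P ≡ ((+ 2) * U + (+ 1)) * ((+ 2) * U + (+ 1)) + (+ 2) * (Y * Y)
  p≡[2u+1]²+2y² = from-identity (λ V → (+ 2) * V + (+ 1)) (+ 2) identity₃

  p≡[-2u-1]²+2y² : P ≡ (- (+ 2) * U - (+ 1)) * (- (+ 2) * U - (+ 1)) + (+ 2) * (Y * Y)
  p≡[-2u-1]²+2y² = from-identity (λ V → - (+ 2) * V - (+ 1)) (+ 2) identity₄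

open import Data.Nat.Base using (_*_)

lemma2p3 : (s : ℕ) → NonZero s → Prime (pOf (s * s)) →
    ((s * s) % 2 ≡ 0 →
      ((α : ℕ) → Primitive (pOf (s * s)) α → InCoset4 (pOf (s * s)) α 0 2)
      × ((x y : ℤ) → ((+ pOf (s * s)) ≡ x ℤ.* x ℤ.+ (+ 4) ℤ.* (y ℤ.* y) × OneMod4 x)
           ⇔ (x ≡ ℤ.- (+ 2) ℤ.* (+ (s * s)) ℤ.+ (+ 1)
               × (y ≡ (+ 2) ℤ.* (+ s) ⊎ y ≡ ℤ.- ((+ 2) ℤ.* (+ s)))))
      × ((a b : ℤ) → ((+ pOf (s * s)) ≡ a ℤ.* a ℤ.+ (+ 2) ℤ.* (b ℤ.* b) × OneMod4 a)
           ⇔ (a ≡ (+ 2) ℤ.* (+ (s * s)) ℤ.+ (+ 1)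
               × (b ≡ (+ 2) ℤ.* (+ s) ⊎ b ≡ ℤ.- ((+ 2) ℤ.* (+ s))))))
    × ((s * s) % 2 ≡ 1 →
      ((α : ℕ) → Primitive (pOf (s * s)) α → InCoset4 (pOf (s * s)) α 2 2)
      × ((x y : ℤ) → ((+ pOf (s * s)) ≡ x ℤ.* x ℤ.+ (+ 4) ℤ.* (y ℤ.* y) × OneMod4 x)
           ⇔ (x ≡ (+ 2) ℤ.* (+ (s * s)) ℤ.- (+ 1)
               × (y ≡ (+ 2) ℤ.* (+ s) ⊎ y ≡ ℤ.- ((+ 2) ℤ.* (+ s)))))
      × ((a b : ℤ) → ((+ pOf (s * s)) ≡ a ℤ.* a ℤ.+ (+ 2) ℤ.* (b ℤ.* b) × OneMod4 a)
           ⇔ (a ≡ ℤ.- (+ 2) ℤ.* (+ (s * s)) ℤ.- (+ 1)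
               × (b ≡ (+ 2) ℤ.* (+ s) ⊎ b ≡ ℤ.- ((+ 2) ℤ.* (+ s))))))
lemma2p3 s s≢0 p-prime =
    (λ u-even → proj₁ coset-of-2 u-even
              , representation-unique {n = 4} p-prime 2≤4 (p≡[1-2u]²+4y² s) (proj₁ (OneMod4-even (s * s) u-even))
              , representation-unique {n = 2} p-prime 2≤2 (p≡[2u+1]²+2y² s) (proj₂ (OneMod4-even (s * s) u-even)))
  , (λ u-odd → proj₂ coset-of-2 u-odd
              , representation-unique {n = 4} p-prime 2≤4 (p≡[2u-1]²+4y² s) (proj₁ (OneMod4-odd (s * s) u-odd))
              , representation-unique {n = 2} p-prime 2≤2 (p≡[-2u-1]²+2y² s) (proj₂ (OneMod4-odd (s * s) u-odd)))
  where
  coset-of-2 = quartic-character-of-2 s s≢0 p-prime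
  2≤4 : 2 ℕ.≤ 4
  2≤4 = s≤s (s≤s z≤n)
  2≤2 : 2 ℕ.≤ 2
  2≤2 = s≤s (s≤s z≤n)
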